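{- Let $G$ be a distance-regular graph of diameter $2$. Then $G$ exhibits perfect state transfer (for the Grover walk) if and only if $G$ is isomorphic to the cycle $C_4$ or to the complete tripartite graph $K_{2,2,2}$.
   Context: A connected graph $G$ is distance-regular if for any vertices $u,v$ the number of vertices at distance $i$ from $u$ and distance $j$ from $v$ depends only on $i,j$ and $\operatorname{dist}(u,v)$. Grover walk: for a finite simple graph $G$ without isolated vertices, arcs $\mathcal{A}(G)=\{(u,v),(v,u):uv\in E(G)\}$, $t((u,v))=v$, $(u,v)^{ -1}=(v,u)$; shift $S_{ab}=\delta_{a,b^{ -1}}$; boundary $N_{ua}=\frac{1}{\sqrt{\deg u}}\delta_{u,t(a)}$; $U=S(2N^*N-I)$; $\Phi_u=N^*\mathbf{e}_u$. $G$ exhibits perfect state transfer if there exist vertices $u\ne v$, a positive integer $\tau$ and a unimodular $\gamma\in\mathbb{C}$ with $U^\tau\Phi_u=\gamma\Phi_v$. -}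

module Defs where

open import Data.Nat as ℕ using (ℕ; zero; suc)
open import Data.Fin using (Fin; zero; suc)
open import Data.Fin.Properties using (_≟_)
open import Data.Bool using (Bool; true; false; _∧_; _∨_; not; if_then_else_; T)
open import Data.Integer using (+_)
open import Data.Rational as ℚ using (ℚ; 0ℚ; 1ℚ; _/_)
open import Data.Product using (Σ; ∃; ∃-syntax; _×_; _,_)
open import Function.Bundles using (_↔_; Inverse)
open import Relation.Binary.PropositionalEquality using (_≡_; _≢_; refl)
open import Relation.Nullary using (does; yes; no)

record Graph : Set where
  field
    n          : ℕ
    adj        : Fin n → Fin n → Bool
    adj-sym    : ∀ x y → adj x y ≡ adj y x
    adj-irrefl : ∀ x → adj x x ≡ false
open Graph public

sumℚ : ∀ {m} → (Fin m → ℚ) → ℚ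
sumℚ {zero}  f = 0ℚ
sumℚ {suc m} f = f zero ℚ.+ sumℚ (λ i → f (suc i))

count : ∀ {m} → (Fin m → Bool) → ℕ
count {zero}  p = 0
count {suc m} p = (if p zero then 1 else 0) ℕ.+ count (λ i → p (suc i))

anyFin : ∀ {m} → (Fin m → Bool) → Bool
anyFin {zero}  p = false
anyFin {suc m} p = p zero ∨ anyFin (λ i → p (suc i))

deg : (G : Graph) → Fin (n G) → ℕ
deg G x = count (adj G x)

ℕtoℚ : ℕ → ℚ
ℕtoℚ d = + d / 1

within : (G : Graph) → ℕ → Fin (n G) → Fin (n G) → Bool
within G zero    u v = does (u ≟ v)
within G (suc k) u v = within G k u v ∨ anyFin (λ w → adj G u w ∧ within G k w v)

distIs : (G : Graph) → ℕ → Fin (n G) → Fin (n G) → Bool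
distIs G zero    u v = within G zero u v
distIs G (suc k) u v = within G (suc k) u v ∧ not (within G k u v)

Connected : Graph → Set
Connected G = ∀ u v → ∃[ k ] T (within G k u v)

interNum : (G : Graph) → ℕ → ℕ → Fin (n G) → Fin (n G) → ℕ
interNum G i j u v = count (λ w → distIs G i u w ∧ distIs G j v w)

DistanceRegular : Graph → Set
DistanceRegular G =
  Connected G ×
  (∀ h i j u v u′ v′ → T (distIs G h u v) → T (distIs G h u′ v′) →
     interNum G i j u v ≡ interNum G i j u′ v′)

Diameter2 : Graph → Set
Diameter2 G = (∀ u v → T (within G 2 u v)) × (∃[ u ] ∃[ v ] T (distIs G 2 u v))

-- Arc-indexed vectors are functions ψ : Fin n → Fin n → ℚ,
-- ψ x y being the entry at arc (x,y) (and 0 on non-arcs).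
-- (2N*N - I)_{ab} = (2/deg t(a)) [t(a) = t(b)] - [a = b]  (rational),
-- and S maps the entry at a⁻¹ to a, so for an arc (x,y):
--   (Uψ)(x,y) = (2/deg x) Σ_{w ~ x} ψ(w,x) - ψ(y,x).

twoOver : ℕ → ℚ
twoOver zero    = 0ℚ
twoOver (suc k) = + 2 / suc k

U : (G : Graph) → (Fin (n G) → Fin (n G) → ℚ) → (Fin (n G) → Fin (n G) → ℚ)
U G ψ x y =
  if adj G x y
  then (twoOver (deg G x) ℚ.* sumℚ (λ w → if adj G w x then ψ w x else 0ℚ)) ℚ.- ψ y x
  else 0ℚ

-- χ u = √(deg u) · Φ_u : indicator of arcs with terminus u
χ : (G : Graph) → Fin (n G) → (Fin (n G) → Fin (n G) → ℚ)
χ G u x y = if adj G x y ∧ does (y ≟ u) then 1ℚ else 0ℚ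

iter : ∀ {A : Set} → ℕ → (A → A) → A → A
iter zero    f a = a
iter (suc k) f a = f (iter k f a)

-- U^τ Φ_u = γ Φ_v with |γ| = 1  ⇔  U^τ χ_u = c χ_v with c = γ √(deg u / deg v);
-- since U^τ χ_u is a rational vector, c ranges over ℚ with c² deg v = deg u.
PerfectStateTransfer : Graph → Set
PerfectStateTransfer G =
  ∃[ u ] ∃[ v ] (u ≢ v) × ∃[ τ ] (1 ℕ.≤ τ) × ∃[ c ]
    (c ℚ.* c ℚ.* ℕtoℚ (deg G v) ≡ ℕtoℚ (deg G u)) ×
    (∀ x y → iter τ (U G) (χ G u) x y ≡ c ℚ.* χ G v x y)

Isomorphic : Graph → Graph → Set
Isomorphic G H = Σ (Fin (n G) ↔ Fin (n H)) λ f →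
  ∀ x y → adj G x y ≡ adj H (Inverse.to f x) (Inverse.to f y)

private
  does-sym : ∀ {m} (a b : Fin m) → does (a ≟ b) ≡ does (b ≟ a)
  does-sym a b with a ≟ b | b ≟ a
  ... | yes _ | yes _ = refl
  ... | no _  | no _  = refl
  ... | yes refl | no ¬p = Data.Empty.⊥-elim (¬p refl) where import Data.Empty
  ... | no ¬p | yes refl = Data.Empty.⊥-elim (¬p refl) where import Data.Empty

  does-refl : ∀ {m} (a : Fin m) → does (a ≟ a) ≡ true
  does-refl a with a ≟ a
  ... | yes _ = refl
  ... | no ¬p = Data.Empty.⊥-elim (¬p refl) where import Data.Empty

multipartite : ∀ {m k} → (Fin m → Fin k) → Graph
multipartite {m} part = record
  { n = m
  ; adj = λ x y → not (does (part x ≟ part y))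
  ; adj-sym = λ x y → Relation.Binary.PropositionalEquality.cong not (does-sym (part x) (part y))
  ; adj-irrefl = λ x → Relation.Binary.PropositionalEquality.cong not (does-refl (part x))
  }

-- C₄ : 0-1-2-3-0, i.e. K_{2,2} with parts {0,2}, {1,3}
c4part : Fin 4 → Fin 2
c4part zero = zero
c4part (suc zero) = suc zero
c4part (suc (suc zero)) = zero
c4part (suc (suc (suc zero))) = suc zero

C4 : Graph
C4 = multipartite c4part

k222part : Fin 6 → Fin 3
k222part zero = zero
k222part (suc zero) = suc zero
k222part (suc (suc zero)) = suc (suc zero)
k222part (suc (suc (suc zero))) = zero
k222part (suc (suc (suc (suc zero)))) = suc zero
k222part (suc (suc (suc (suc (suc zero))))) = suc (suc zero)

K222 : Graph
K222 = multipartite k222part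

-- Fix a vertex u and sort the vertices by their distance 0, 1 or 2 from u.  In a distance-regular
-- graph this partition is equitable, and then the walk started at χ_u stays constant on classes:
-- on an arc (x,y), U^t χ_u equals atTail(class x) − atHead(class y) for two 3-vectors obeying a
-- linear recursion.  Two arcs with the same pair of classes carry the same value, so transfer to v
-- forces v to be the only vertex at distance 2 from u; by distance-regularity every vertex then has
-- a unique antipode, i.e. G is a cocktail party graph, of some degree k ≥ 2.  There the second
-- difference f₀ + f₂ − 2f₁ of atTail is the Lucas sequence U_t(−4/k, 1), and for k ≥ 3 transfer at
-- time τ makes it vanish at τ.  With 4/k = a/b in lowest terms, b^(t−1) U_t is an integer congruent
-- to (−a)^(t−1) modulo b, so it vanishes only if b = 1, which leaves k = 2 (C₄) and k = 4 (K_{2,2,2}).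
-- For these two graphs evaluating the recursion at t = 2 and t = 6 exhibits the transfer.

module Submission where

open import Defs
open import Data.Bool using (Bool; true; false; _∧_; _∨_; not; if_then_else_; T)
import Data.Bool.Properties as Boolₚ
open import Data.Empty using (⊥; ⊥-elim)
open import Data.Fin using (Fin; zero; suc; toℕ; splitAt; join)
open import Data.Fin.Patterns using (0F; 1F; 2F)
import Data.Fin.Properties as Finₚ
open import Data.Fin.Properties using (_≟_; all?)
open import Data.Integer as ℤ using (ℤ; +_)
import Data.Integer.Properties as ℤₚ
open import Data.Nat as ℕ using (ℕ; zero; suc; _≤_; z≤n; s≤s; _∸_)
import Data.Nat.Properties as ℕₚ
import Data.Nat.Coprimality as Cop
open import Data.Nat.Divisibility using (_∣_; _∣?_; divides; ∣1⇒≡1; ∣⇒≤)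
open import Data.Nat.DivMod using (m/n*n≡m)
open import Data.Nat.GCD using (gcd; gcd[m,n]∣m; gcd[m,n]∣n; gcd[m,n]≢0)
import Data.Nat.Solver as ℕSolver
open import Data.Product using (∃; ∃₂; _×_; _,_; proj₁; proj₂)
open import Data.Rational as ℚ using (ℚ; 0ℚ; 1ℚ; _/_)
import Data.Rational.Properties as ℚₚ
open import Data.Rational.Solver using (module +-*-Solver)
import Data.Rational.Unnormalised as ℚᵘ
import Data.Rational.Unnormalised.Properties as ℚᵘₚ
open import Data.Sum using (_⊎_; inj₁; inj₂; [_,_]′)
import Data.Sum as Sum
open import Function using (_∘_)
open import Function.Bundles using (module Equivalence; _⇔_; mk⇔; _↔_; Inverse; mk↔ₛ′)
open import Relation.Binary.PropositionalEquality
open import Relation.Nullary using (does; yes; no; ¬_; contradiction)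
open import Relation.Nullary.Decidable using (dec-true; dec-false; does-⇔; toWitness; toWitnessFalse)

open +-*-Solver
import Data.Integer.Solver as ℤSolver
open ℤSolver.+-*-Solver using ()
  renaming (solve to ℤsolve; con to ℤcon; _:+_ to _⊕_; _:*_ to _⊛_; :-_ to ⊝_; _:=_ to _⩦_)
open ℕSolver.+-*-Solver using ()
  renaming (solve to ℕsolve; con to ℕcon; _:+_ to _⊕ₙ_; _:*_ to _⊛ₙ_; _:=_ to _⩦ₙ_)
open import Algebra.Properties.Group ℚₚ.+-0-group using (x∙y⁻¹≈ε⇒x≈y)

private
  variable
    m r : ℕ

infix 4 _==_
_==_ : Fin m → Fin m → Bool
a == b = does (a ≟ b)

==-refl : (a : Fin m) → (a == a) ≡ true
==-refl a = dec-true (a ≟ a) refl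

≡⇒== : {a b : Fin m} → a ≡ b → (a == b) ≡ true
≡⇒== {a = a} refl = ==-refl a

≢⇒== : {a b : Fin m} → a ≢ b → (a == b) ≡ false
≢⇒== {a = a} {b} = dec-false (a ≟ b)

==⇒≡ : {a b : Fin m} → (a == b) ≡ true → a ≡ b
==⇒≡ {a = a} {b} e with a ≟ b
... | yes a≡b = a≡b

==-sym : (a b : Fin m) → (a == b) ≡ (b == a)
==-sym a b = does-⇔ (mk⇔ sym sym) (a ≟ b) (b ≟ a)

true≢false : true ≢ false
true≢false ()

not==⇒≢ : {a b : Fin m} → not (a == b) ≡ true → a ≢ b
not==⇒≢ {a = a} ne refl = true≢false (trans (sym ne) (cong not (==-refl a)))

∧-true : ∀ {a b} → (a ∧ b) ≡ true → a ≡ true × b ≡ true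
∧-true {true} {true} _ = refl , refl

T⇒≡true : ∀ {b} → T b → b ≡ true
T⇒≡true = Equivalence.to Boolₚ.T-≡

≡true⇒T : ∀ {b} → b ≡ true → T b
≡true⇒T = Equivalence.from Boolₚ.T-≡

count-cong : {p q : Fin m → Bool} → (∀ i → p i ≡ q i) → count p ≡ count q
count-cong {zero}  eq = refl
count-cong {suc m} eq rewrite eq zero = cong (_ ℕ.+_) (count-cong (λ i → eq (suc i)))

count-true : count {m} (λ _ → true) ≡ m
count-true {zero}  = refl
count-true {suc m} = cong suc (count-true {m})

count-false : count {m} (λ _ → false) ≡ 0
count-false {zero}  = refl
count-false {suc m} = count-false {m}

count-split : (p q : Fin m → Bool) →
  count p ≡ count (λ w → p w ∧ q w) ℕ.+ count (λ w → p w ∧ not (q w))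
count-split {zero}  p q = refl
count-split {suc m} p q with p zero | q zero
... | false | _     = count-split (λ i → p (suc i)) (λ i → q (suc i))
... | true  | true  = cong suc (count-split (λ i → p (suc i)) (λ i → q (suc i)))
... | true  | false = trans (cong suc (count-split (λ i → p (suc i)) (λ i → q (suc i))))
                           (sym (ℕₚ.+-suc _ _))

count-at : (p : Fin m → Bool) (v : Fin m) →
  count (λ w → p w ∧ (w == v)) ≡ (if p v then 1 else 0)
count-at {suc m} p zero with p zero
... | true  = cong suc (trans (count-cong (λ i → Boolₚ.∧-zeroʳ (p (suc i)))) (count-false {m}))
... | false = trans (count-cong (λ i → Boolₚ.∧-zeroʳ (p (suc i)))) (count-false {m})
count-at {suc m} p (suc v) rewrite Boolₚ.∧-zeroʳ (p zero) = count-at (λ i → p (suc i)) v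

count-split-at : (p : Fin m → Bool) (v : Fin m) →
  count p ≡ (if p v then 1 else 0) ℕ.+ count (λ w → p w ∧ not (w == v))
count-split-at p v =
  trans (count-split p (_== v)) (cong (ℕ._+ count (λ w → p w ∧ not (w == v))) (count-at p v))

∃⇒1≤count : (p : Fin m → Bool) (i : Fin m) → p i ≡ true → 1 ≤ count p
∃⇒1≤count {suc m} p zero pi =
  subst (λ b → 1 ≤ (if b then 1 else 0) ℕ.+ count (λ j → p (suc j))) (sym pi) (s≤s z≤n)
∃⇒1≤count p (suc i) pi = ℕₚ.≤-trans (∃⇒1≤count (λ j → p (suc j)) i pi) (ℕₚ.m≤n+m _ _)

1≤count⇒∃ : (p : Fin m → Bool) → 1 ≤ count p → ∃ λ i → p i ≡ true
1≤count⇒∃ {suc m} p le with p zero in eq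
... | true  = zero , eq
... | false = let i , pi = 1≤count⇒∃ (λ i → p (suc i)) le in suc i , pi

2≤count⇒∃≢ : (p : Fin m → Bool) → 2 ≤ count p → ∀ v → ∃ λ i → i ≢ v × p i ≡ true
2≤count⇒∃≢ p 2≤count v =
  let i , pi∧i≢v = 1≤count⇒∃ (λ w → p w ∧ not (w == v))
                     (one-left (p v) (subst (2 ≤_) (count-split-at p v) 2≤count))
      pi , i≢v   = ∧-true {p i} pi∧i≢v
  in i , not==⇒≢ i≢v , pi
  where
  one-left : ∀ b {c} → 2 ≤ (if b then 1 else 0) ℕ.+ c → 1 ≤ c
  one-left true  (s≤s 1≤c) = 1≤c
  one-left false 2≤c       = ℕₚ.≤-trans (s≤s z≤n) 2≤c

≢⇒2≤count : (p : Fin m → Bool) {a b : Fin m} → p a ≡ true → p b ≡ true → a ≢ b → 2 ≤ count p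
≢⇒2≤count p {a} {b} pa pb a≢b rewrite count-split-at p a | pa =
  s≤s (∃⇒1≤count (λ w → p w ∧ not (w == a)) b (cong₂ _∧_ pb (cong not (≢⇒== (a≢b ∘ sym)))))

count≡1⇒unique : (p : Fin m → Bool) → count p ≡ 1 → ∀ {a b} → p a ≡ true → p b ≡ true → a ≡ b
count≡1⇒unique p c≡1 {a} {b} pa pb with a ≟ b
... | yes a≡b = a≡b
... | no  a≢b = ⊥-elim (ℕₚ.<-irrefl (sym c≡1) (≢⇒2≤count p pa pb a≢b))

count-avoiding-two : {a b : Fin m} → a ≢ b → count (λ w → not (w == a) ∧ not (w == b)) ℕ.+ 2 ≡ m
count-avoiding-two {m} {a} {b} a≢b = begin
  rest ℕ.+ 2
    ≡⟨ ℕₚ.+-comm rest 2 ⟩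
  1 ℕ.+ (1 ℕ.+ rest)
    ≡⟨ cong (λ e → 1 ℕ.+ ((if not e then 1 else 0) ℕ.+ rest)) (sym (≢⇒== (a≢b ∘ sym))) ⟩
  1 ℕ.+ ((if not (b == a) then 1 else 0) ℕ.+ rest)
    ≡⟨ sym (cong (1 ℕ.+_) (count-split-at (λ w → not (w == a)) b)) ⟩
  1 ℕ.+ count (λ w → not (w == a))
    ≡⟨ sym (count-split-at (λ _ → true) a) ⟩
  count {m} (λ _ → true)
    ≡⟨ count-true ⟩
  m ∎
  where
  open ≡-Reasoning
  rest = count (λ w → not (w == a) ∧ not (w == b))

classCount : (Fin m → Bool) → (Fin m → Fin r) → Fin r → ℕ
classCount p c j = count (λ w → p w ∧ (c w == j))

count-classes₃ : (p : Fin m → Bool) (c : Fin m → Fin 3) →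
  count p ≡ classCount p c 0F ℕ.+ (classCount p c 1F ℕ.+ classCount p c 2F)
count-classes₃ {zero}  p c = refl
count-classes₃ {suc m} p c with p zero | c zero | count-classes₃ (λ i → p (suc i)) (λ i → c (suc i))
... | false | _  | IH = IH
... | true  | 0F | IH = cong suc IH
... | true  | 1F | IH = trans (cong suc IH) (sym (ℕₚ.+-suc _ _))
... | true  | 2F | IH = trans (cong suc IH) (sym (trans (cong (N 0F ℕ.+_) (ℕₚ.+-suc (N 1F) (N 2F)))
                                                        (ℕₚ.+-suc (N 0F) (N 1F ℕ.+ N 2F))))
  where N = classCount (λ i → p (suc i)) (λ i → c (suc i))

anyFin-at : (p : Fin m → Bool) (v : Fin m) → anyFin (λ w → p w ∧ (w == v)) ≡ p v
anyFin-at {suc m} p zero rewrite Boolₚ.∧-identityʳ (p zero) with p zero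
... | true  = refl
... | false = anyFin-false (λ i → Boolₚ.∧-zeroʳ (p (suc i)))
  where
  anyFin-false : ∀ {m} {q : Fin m → Bool} → (∀ i → q i ≡ false) → anyFin q ≡ false
  anyFin-false {zero}      eq = refl
  anyFin-false {suc m} {q} eq rewrite eq zero = anyFin-false (λ i → eq (suc i))
anyFin-at {suc m} p (suc v) rewrite Boolₚ.∧-zeroʳ (p zero) = anyFin-at (λ i → p (suc i)) v

anyFin⇒∃ : (p : Fin m → Bool) → anyFin p ≡ true → ∃ λ i → p i ≡ true
anyFin⇒∃ {suc m} p e with p zero in eq
... | true  = zero , eq
... | false = let i , pi = anyFin⇒∃ (λ i → p (suc i)) e in suc i , pi

factor-through : (c : Fin m → Fin r) (f : Fin m → ℕ) → (∀ x y → c x ≡ c y → f x ≡ f y) →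
  ∃ λ g → ∀ x → f x ≡ g (c x)
factor-through c f f-const = g , f≡g∘c
  where
  g : Fin _ → ℕ
  g h with Finₚ.any? (λ w → c w ≟ h)
  ... | yes (w , _) = f w
  ... | no _        = 0
  f≡g∘c : ∀ x → f x ≡ g (c x)
  f≡g∘c x with Finₚ.any? (λ w → c w ≟ c x)
  ... | yes (w , cw≡cx) = f-const x w (sym cw≡cx)
  ... | no ∄w           = ⊥-elim (∄w (x , refl))

ℤtoℚ : ℤ → ℚ
ℤtoℚ i = i / 1

private
  toℚᵘ-ℤtoℚ : ∀ i → ℚ.toℚᵘ (ℤtoℚ i) ℚᵘ.≃ ℚᵘ.mkℚᵘ i 0
  toℚᵘ-ℤtoℚ i = ℚₚ.toℚᵘ-fromℚᵘ (ℚᵘ.mkℚᵘ i 0)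

ℤtoℚ-+ : ∀ i j → ℤtoℚ (i ℤ.+ j) ≡ ℤtoℚ i ℚ.+ ℤtoℚ j
ℤtoℚ-+ i j = ℚₚ.toℚᵘ-injective (ℚᵘₚ.≃-trans (toℚᵘ-ℤtoℚ (i ℤ.+ j)) (ℚᵘₚ.≃-trans (ℚᵘ.*≡* eq)
  (ℚᵘₚ.≃-trans (ℚᵘₚ.+-cong (ℚᵘₚ.≃-sym (toℚᵘ-ℤtoℚ i)) (ℚᵘₚ.≃-sym (toℚᵘ-ℤtoℚ j)))
               (ℚᵘₚ.≃-sym (ℚₚ.toℚᵘ-homo-+ (ℤtoℚ i) (ℤtoℚ j))))))
  where
  eq : (i ℤ.+ j) ℤ.* + 1 ≡ (i ℤ.* + 1 ℤ.+ j ℤ.* + 1) ℤ.* + 1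
  eq = cong (ℤ._* + 1) (sym (cong₂ ℤ._+_ (ℤₚ.*-identityʳ i) (ℤₚ.*-identityʳ j)))

ℤtoℚ-* : ∀ i j → ℤtoℚ (i ℤ.* j) ≡ ℤtoℚ i ℚ.* ℤtoℚ j
ℤtoℚ-* i j = ℚₚ.toℚᵘ-injective (ℚᵘₚ.≃-trans (toℚᵘ-ℤtoℚ (i ℤ.* j)) (ℚᵘₚ.≃-trans (ℚᵘ.*≡* refl)
  (ℚᵘₚ.≃-trans (ℚᵘₚ.*-cong (ℚᵘₚ.≃-sym (toℚᵘ-ℤtoℚ i)) (ℚᵘₚ.≃-sym (toℚᵘ-ℤtoℚ j)))
               (ℚᵘₚ.≃-sym (ℚₚ.toℚᵘ-homo-* (ℤtoℚ i) (ℤtoℚ j))))))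

ℤtoℚ-neg : ∀ i → ℤtoℚ (ℤ.- i) ≡ ℚ.- ℤtoℚ i
ℤtoℚ-neg i = ℚₚ.toℚᵘ-injective (ℚᵘₚ.≃-trans (toℚᵘ-ℤtoℚ (ℤ.- i)) (ℚᵘₚ.≃-trans (ℚᵘ.*≡* refl)
  (ℚᵘₚ.≃-trans (ℚᵘₚ.-‿cong (ℚᵘₚ.≃-sym (toℚᵘ-ℤtoℚ i))) (ℚᵘₚ.≃-sym (ℚₚ.toℚᵘ-homo‿- (ℤtoℚ i))))))

ℤtoℚ≡0 : ∀ i → ℤtoℚ i ≡ 0ℚ → i ≡ + 0
ℤtoℚ≡0 i e
  with ℚᵘₚ.≃-trans (ℚᵘₚ.≃-sym (toℚᵘ-ℤtoℚ i)) (ℚᵘₚ.≃-trans (ℚₚ.toℚᵘ-cong e) (toℚᵘ-ℤtoℚ (+ 0)))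
... | ℚᵘ.*≡* eq = trans (sym (ℤₚ.*-identityʳ i)) eq

ℤtoℚ-- : ∀ i j → ℤtoℚ (i ℤ.- j) ≡ ℤtoℚ i ℚ.- ℤtoℚ j
ℤtoℚ-- i j = trans (ℤtoℚ-+ i (ℤ.- j)) (cong (ℤtoℚ i ℚ.+_) (ℤtoℚ-neg j))

ℕtoℚ-+ : ∀ a b → ℕtoℚ (a ℕ.+ b) ≡ ℕtoℚ a ℚ.+ ℕtoℚ b
ℕtoℚ-+ a b = ℤtoℚ-+ (+ a) (+ b)

ℕtoℚ-* : ∀ a b → ℕtoℚ (a ℕ.* b) ≡ ℕtoℚ a ℚ.* ℕtoℚ b
ℕtoℚ-* a b = trans (cong ℤtoℚ (ℤₚ.pos-* a b)) (ℤtoℚ-* (+ a) (+ b))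

sumℚ-cong : {f g : Fin m → ℚ} → (∀ i → f i ≡ g i) → sumℚ f ≡ sumℚ g
sumℚ-cong {zero}  eq = refl
sumℚ-cong {suc m} eq = cong₂ ℚ._+_ (eq zero) (sumℚ-cong (λ i → eq (suc i)))

sumℚ-zero : {f : Fin m → ℚ} → (∀ i → f i ≡ 0ℚ) → sumℚ f ≡ 0ℚ
sumℚ-zero {zero}  eq = refl
sumℚ-zero {suc m} eq = cong₂ ℚ._+_ (eq zero) (sumℚ-zero (λ i → eq (suc i)))

sumℚ-+ : (f g : Fin m → ℚ) → sumℚ (λ i → f i ℚ.+ g i) ≡ sumℚ f ℚ.+ sumℚ g
sumℚ-+ {zero}  f g = refl
sumℚ-+ {suc m} f g =
  trans (cong (f zero ℚ.+ g zero ℚ.+_) (sumℚ-+ (λ i → f (suc i)) (λ i → g (suc i))))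
        (solve 4 (λ a b c d → (a :+ b) :+ (c :+ d) := (a :+ c) :+ (b :+ d)) refl
               (f zero) (g zero) (sumℚ (λ i → f (suc i))) (sumℚ (λ i → g (suc i))))

sumℚ-indicator : (F : Fin r → ℚ) (b : Bool) (i : Fin r) →
  sumℚ (λ j → F j ℚ.* ℕtoℚ (if b ∧ (i == j) then 1 else 0)) ≡ (if b then F i else 0ℚ)
sumℚ-indicator F false i = sumℚ-zero (λ j → ℚₚ.*-zeroʳ (F j))
sumℚ-indicator {suc r} F true zero =
  trans (cong (F zero ℚ.* 1ℚ ℚ.+_) (sumℚ-zero (λ j → ℚₚ.*-zeroʳ (F (suc j)))))
        (solve 1 (λ x → x :* con 1ℚ :+ con 0ℚ := x) refl (F zero))
sumℚ-indicator {suc r} F true (suc i) =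
  trans (cong (F zero ℚ.* 0ℚ ℚ.+_) (sumℚ-indicator (λ j → F (suc j)) true i))
        (solve 1 (λ x → x :* con 0ℚ :+ con (F (suc i)) := con (F (suc i))) refl (F zero))

sumℚ-classes : (p : Fin m → Bool) (c : Fin m → Fin r) (F : Fin r → ℚ) →
  sumℚ (λ w → if p w then F (c w) else 0ℚ) ≡
  sumℚ (λ j → F j ℚ.* ℕtoℚ (classCount p c j))
sumℚ-classes {zero}  p c F = sym (sumℚ-zero (λ j → ℚₚ.*-zeroʳ (F j)))
sumℚ-classes {suc m} p c F = begin
  (if p zero then F (c zero) else 0ℚ) ℚ.+ sumℚ (λ w → if p (suc w) then F (c (suc w)) else 0ℚ)
    ≡⟨ cong₂ ℚ._+_ (sym (sumℚ-indicator F (p zero) (c zero)))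
                   (sumℚ-classes (λ w → p (suc w)) (λ w → c (suc w)) F) ⟩
  sumℚ (λ j → F j ℚ.* ℕtoℚ (here j)) ℚ.+ sumℚ (λ j → F j ℚ.* ℕtoℚ (later j))
    ≡⟨ sym (sumℚ-+ (λ j → F j ℚ.* ℕtoℚ (here j)) (λ j → F j ℚ.* ℕtoℚ (later j))) ⟩
  sumℚ (λ j → F j ℚ.* ℕtoℚ (here j) ℚ.+ F j ℚ.* ℕtoℚ (later j))
    ≡⟨ sumℚ-cong (λ j → trans (sym (ℚₚ.*-distribˡ-+ (F j) _ _))
                              (cong (F j ℚ.*_) (sym (ℕtoℚ-+ (here j) (later j))))) ⟩
  sumℚ (λ j → F j ℚ.* ℕtoℚ (here j ℕ.+ later j)) ∎
  where
  open ≡-Reasoning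
  here : Fin _ → ℕ
  here j = if p zero ∧ (c zero == j) then 1 else 0
  later = classCount (λ w → p (suc w)) (λ w → c (suc w))

distClass : (G : Graph) → Fin (n G) → Fin (n G) → Fin 3
distClass G u w = if u == w then 0F else if adj G u w then 1F else 2F

module _ (G : Graph) where

  private
    V = Fin (n G)

  distClass-self : (u : V) → distClass G u u ≡ 0F
  distClass-self u rewrite ==-refl u = refl

  distClass==0F : (u w : V) → (distClass G u w == 0F) ≡ (u == w)
  distClass==0F u w with u == w | adj G u w
  ... | true  | _     = refl
  ... | false | true  = refl
  ... | false | false = refl

  distClass==1F : (u w : V) → (distClass G u w == 1F) ≡ adj G u w
  distClass==1F u w with u ≟ w
  ... | yes refl rewrite adj-irrefl G u = refl
  ... | no _ with adj G u w
  ...   | true  = refl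
  ...   | false = refl

  distClass≡0F : {u w : V} → distClass G u w ≡ 0F → u ≡ w
  distClass≡0F {u} {w} e = ==⇒≡ (trans (sym (distClass==0F u w)) (≡⇒== e))

  distClass≡1F : {u w : V} → distClass G u w ≡ 1F → adj G u w ≡ true
  distClass≡1F {u} {w} e = trans (sym (distClass==1F u w)) (≡⇒== e)

  distClass-adj : {u w : V} → adj G u w ≡ true → distClass G u w ≡ 1F
  distClass-adj {u} {w} e = ==⇒≡ (trans (distClass==1F u w) e)

  distClass≡2F : {u w : V} → distClass G u w ≡ 2F → u ≢ w × adj G u w ≡ false
  distClass≡2F {u} {w} e with u == w in u=w | adj G u w
  distClass≡2F () | true  | _
  distClass≡2F () | false | true
  ... | false | false = (λ u≡w → true≢false (trans (sym (≡⇒== u≡w)) u=w)) , refl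

  distClass==2F-apart : {u w : V} → u ≢ w → (distClass G u w == 2F) ≡ not (adj G u w)
  distClass==2F-apart {u} {w} u≢w rewrite ≢⇒== u≢w with adj G u w
  ... | true  = refl
  ... | false = refl

  distClass-sym : (u w : V) → distClass G u w ≡ distClass G w u
  distClass-sym u w rewrite ==-sym u w | adj-sym G u w = refl

module DiameterTwo (G : Graph) (within₂ : ∀ u v → T (within G 2 u v)) where

  private
    V = Fin (n G)

  within-1 : (u v : V) → within G 1 u v ≡ ((u == v) ∨ adj G u v)
  within-1 u v = cong ((u == v) ∨_) (anyFin-at (adj G u) v)

  distIs-distClass : (j : Fin 3) (u w : V) → distIs G (toℕ j) u w ≡ (distClass G u w == j)
  distIs-distClass 0F u w = sym (distClass==0F G u w)
  distIs-distClass 1F u w rewrite within-1 u w with u ≟ w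
  ... | yes refl = refl
  ... | no _ rewrite Boolₚ.∧-identityʳ (adj G u w) with adj G u w
  ...   | true  = refl
  ...   | false = refl
  distIs-distClass 2F u w rewrite T⇒≡true (within₂ u w) | within-1 u w with u ≟ w
  ... | yes refl = refl
  ... | no _ with adj G u w
  ...   | true  = refl
  ...   | false = refl

  common-neighbour : {u y : V} → distClass G u y ≡ 2F → ∃ λ x → adj G u x ≡ true × adj G x y ≡ true
  common-neighbour {u} {y} uy with distClass≡2F G {u} {y} uy
  ... | u≢y , ¬uy = go (T⇒≡true (within₂ u y))
    where
    u≁y : within G 1 u y ≡ false
    u≁y = trans (within-1 u y) (cong₂ _∨_ (≢⇒== u≢y) ¬uy)
    go : (within G 1 u y ∨ anyFin (λ x → adj G u x ∧ within G 1 x y)) ≡ true →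
         ∃ λ x → adj G u x ≡ true × adj G x y ≡ true
    go w₂ with anyFin⇒∃ _ (subst (λ b → (b ∨ anyFin (λ x → adj G u x ∧ within G 1 x y)) ≡ true)
                                 u≁y w₂)
    ... | x , ux∧xy with ∧-true {adj G u x} ux∧xy
    ... | ux , xy with x ≟ y | trans (sym (within-1 x y)) xy
    ...   | yes refl | _   = ⊥-elim (true≢false (trans (sym ux) ¬uy))
    ...   | no _     | x~y = x , ux , x~y

Equitable : (G : Graph) → (Fin (n G) → Fin r) → (Fin r → Fin r → ℕ) → Set
Equitable G c P = ∀ x j → classCount (adj G x) c j ≡ P (c x) j

module DistanceRegularDiameterTwo (G : Graph) (drg : DistanceRegular G)
                                  (within₂ : ∀ u v → T (within G 2 u v)) where

  open DiameterTwo G within₂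

  private
    V = Fin (n G)

    distIs-self : (x : V) → T (distIs G 0 x x)
    distIs-self x = ≡true⇒T (==-refl x)

    interNum-self : ∀ (j : Fin 3) x →
      interNum G (toℕ j) (toℕ j) x x ≡ count (λ w → distClass G x w == j)
    interNum-self j x = count-cong λ w →
      trans (cong₂ _∧_ (distIs-distClass j x w) (distIs-distClass j x w))
            (Boolₚ.∧-idem (distClass G x w == j))

  regular : (x y : V) → deg G x ≡ deg G y
  regular x y = begin
    deg G x                   ≡⟨ count-cong (λ w → sym (distClass==1F G x w)) ⟩
    count (λ w → distClass G x w == 1F) ≡⟨ sym (interNum-self 1F x) ⟩
    interNum G 1 1 x x        ≡⟨ proj₂ drg 0 1 1 x x y y (distIs-self x) (distIs-self y) ⟩
    interNum G 1 1 y y        ≡⟨ interNum-self 1F y ⟩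
    count (λ w → distClass G y w == 1F) ≡⟨ count-cong (distClass==1F G y) ⟩
    deg G y                   ∎
    where open ≡-Reasoning

  antipodes-invariant : (x y : V) →
    count (λ w → distClass G x w == 2F) ≡ count (λ w → distClass G y w == 2F)
  antipodes-invariant x y = begin
    count (λ w → distClass G x w == 2F) ≡⟨ sym (interNum-self 2F x) ⟩
    interNum G 2 2 x x                  ≡⟨ proj₂ drg 0 2 2 x x y y (distIs-self x) (distIs-self y) ⟩
    interNum G 2 2 y y                  ≡⟨ interNum-self 2F y ⟩
    count (λ w → distClass G y w == 2F) ∎
    where open ≡-Reasoning

  2≤deg : (∃₂ λ u v → T (distIs G 2 u v)) → (x : V) → 2 ≤ deg G x
  2≤deg (u , v , uv) x = via-middle (common-neighbour uv₂)
    where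
    uv₂ : distClass G u v ≡ 2F
    uv₂ = ==⇒≡ (trans (sym (distIs-distClass 2F u v)) (T⇒≡true uv))
    via-middle : (∃ λ y → adj G u y ≡ true × adj G y v ≡ true) → 2 ≤ deg G x
    via-middle (y , uy , yv) = subst (2 ≤_) (regular y x)
      (≢⇒2≤count (adj G y) (trans (adj-sym G y u) uy) yv (proj₁ (distClass≡2F G uv₂)))

  distance-partition-equitable : (u : V) → ∃ λ P → Equitable G (distClass G u) P
  distance-partition-equitable u =
    (λ h j → proj₁ (factor-through (distClass G u) (neighbours j) (neighbours-const j)) h) ,
    (λ x j → proj₂ (factor-through (distClass G u) (neighbours j) (neighbours-const j)) x)
    where
    neighbours : Fin 3 → V → ℕ
    neighbours j x = classCount (adj G x) (distClass G u) j

    neighbours≡interNum : ∀ j x → interNum G 1 (toℕ j) x u ≡ neighbours j x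
    neighbours≡interNum j x = count-cong λ w →
      cong₂ _∧_ (trans (distIs-distClass 1F x w) (distClass==1F G x w)) (distIs-distClass j u w)

    neighbours-const : ∀ j x y → distClass G u x ≡ distClass G u y → neighbours j x ≡ neighbours j y
    neighbours-const j x y ux≡uy = begin
      neighbours j x
        ≡⟨ sym (neighbours≡interNum j x) ⟩
      interNum G 1 (toℕ j) x u
        ≡⟨ proj₂ drg (toℕ h) 1 (toℕ j) x u y u (at-distance x refl) (at-distance y yu≡h) ⟩
      interNum G 1 (toℕ j) y u
        ≡⟨ neighbours≡interNum j y ⟩
      neighbours j y ∎
      where
      open ≡-Reasoning
      h = distClass G x u
      at-distance : ∀ z → distClass G z u ≡ h → T (distIs G (toℕ h) z u)
      at-distance z zu≡h = ≡true⇒T (trans (distIs-distClass h z u) (≡⇒== zu≡h))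
      yu≡h : distClass G y u ≡ h
      yu≡h = trans (distClass-sym G y u) (trans (sym ux≡uy) (distClass-sym G u x))

-- The Grover walk on an equitable partition

record ArcWeights (r : ℕ) : Set where
  constructor arcWeights
  field
    atTail atHead : Fin r → ℚ
open ArcWeights

-- For x in class h, (Uψ)(x,y) = z Σ_{w∼x} ψ(w,x) − ψ(y,x); grouping the w by class turns the sum
-- into Σ_j (atTail j − atHead h) P h j, and −ψ(y,x) makes the old atTail the new atHead.
walkStep : (P : Fin r → Fin r → ℕ) → ℚ → ArcWeights r → ArcWeights r
walkStep P z w = arcWeights
  (λ h → z ℚ.* sumℚ (λ j → (atTail w j ℚ.- atHead w h) ℚ.* ℕtoℚ (P h j)) ℚ.+ atHead w h)
  (atTail w)

-- χ u x y = [y = u] = 0 − atHead (class y) when u is alone in its class j₀.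
classWalk : (P : Fin r → Fin r → ℕ) → ℚ → Fin r → ℕ → ArcWeights r
classWalk P z j₀ t =
  iter t (walkStep P z) (arcWeights (λ _ → 0ℚ) (λ j → if j == j₀ then ℚ.- 1ℚ else 0ℚ))

Represents : (G : Graph) → (Fin (n G) → Fin r) → ArcWeights r → (Fin (n G) → Fin (n G) → ℚ) → Set
Represents G c w ψ = ∀ x y → ψ x y ≡ (if adj G x y then atTail w (c x) ℚ.- atHead w (c y) else 0ℚ)

module EquitablePartition (G : Graph) (c : Fin (n G) → Fin r) (P : Fin r → Fin r → ℕ)
    (equitable : Equitable G c P) where

  private
    V = Fin (n G)

  adj⇒1≤P : {x y : V} → adj G x y ≡ true → 1 ≤ P (c x) (c y)
  adj⇒1≤P {x} {y} xy =
    subst (1 ≤_) (equitable x (c y)) (∃⇒1≤count _ y (cong₂ _∧_ xy (==-refl (c y))))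

  transfer-from-classes : ∀ {w ψ} → Represents G c w ψ →
    (v : V) → (∀ y → (c y == c v) ≡ (y == v)) →
    (∀ h j → 1 ≤ P h j → atTail w h ℚ.- atHead w j ≡ (if j == c v then 1ℚ else 0ℚ)) →
    ∀ x y → ψ x y ≡ 1ℚ ℚ.* χ G v x y
  transfer-from-classes {w} rep v class-of-v check x y rewrite rep x y with adj G x y in xy
  ... | false = refl
  ... | true rewrite check (c x) (c y) (adj⇒1≤P xy) | class-of-v y with y == v
  ...   | true  = refl
  ...   | false = refl

  module _ {k : ℕ} (regular : ∀ x → deg G x ≡ k) where

    represents-U : ∀ {w ψ} → Represents G c w ψ →
      Represents G c (walkStep P (twoOver k) w) (U G ψ)
    represents-U {w} {ψ} rep x y with adj G x y in xy
    ... | false = refl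
    ... | true  = begin
      twoOver (deg G x) ℚ.* sumℚ (λ v → if adj G v x then ψ v x else 0ℚ) ℚ.- ψ y x
        ≡⟨ cong₂ (λ d s → twoOver d ℚ.* s ℚ.- ψ y x) (regular x) incoming ⟩
      twoOver k ℚ.* S ℚ.- ψ y x
        ≡⟨ cong (λ a → twoOver k ℚ.* S ℚ.- a) backwards ⟩
      twoOver k ℚ.* S ℚ.- (atTail w (c y) ℚ.- atHead w (c x))
        ≡⟨ solve 4 (λ z S a b → z :* S :- (a :- b) := (z :* S :+ b) :- a) refl
                 (twoOver k) S (atTail w (c y)) (atHead w (c x)) ⟩
      (twoOver k ℚ.* S ℚ.+ atHead w (c x)) ℚ.- atTail w (c y) ∎
      where
      open ≡-Reasoning
      F : Fin _ → ℚ
      F j = atTail w j ℚ.- atHead w (c x)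
      S = sumℚ (λ j → F j ℚ.* ℕtoℚ (P (c x) j))
      arc-into-x : ∀ v → (if adj G v x then ψ v x else 0ℚ) ≡ (if adj G x v then F (c v) else 0ℚ)
      arc-into-x v rewrite rep v x | adj-sym G v x with adj G x v
      ... | true  = refl
      ... | false = refl
      incoming : sumℚ (λ v → if adj G v x then ψ v x else 0ℚ) ≡ S
      incoming = trans (sumℚ-cong arc-into-x) (trans (sumℚ-classes (adj G x) c F)
                   (sumℚ-cong (λ j → cong (λ a → F j ℚ.* ℕtoℚ a) (equitable x j))))
      backwards : ψ y x ≡ atTail w (c y) ℚ.- atHead w (c x)
      backwards = trans (rep y x) (cong (if_then atTail w (c y) ℚ.- atHead w (c x) else 0ℚ)
                                        (trans (adj-sym G y x) xy))

    represents-walk : (u : V) {j₀ : Fin r} → (∀ y → (c y == j₀) ≡ (y == u)) →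
      ∀ t → Represents G c (classWalk P (twoOver k) j₀ t) (iter t (U G) (χ G u))
    represents-walk u {j₀} class-of-u zero x y with adj G x y
    ... | false = refl
    ... | true rewrite class-of-u y with y == u
    ...   | true  = refl
    ...   | false = refl
    represents-walk u class-of-u (suc t) =
      represents-U {classWalk P (twoOver k) _ t} (represents-walk u class-of-u t)

module TransferOnClasses (G : Graph) (c : Fin (n G) → Fin r) (w : ArcWeights r)
    {ψ : Fin (n G) → Fin (n G) → ℚ} (rep : Represents G c w ψ)
    (v : Fin (n G)) (γ : ℚ) (transfer : ∀ x y → ψ x y ≡ γ ℚ.* χ G v x y) where

  private
    V = Fin (n G)

  arc-equation : {x y : V} → adj G x y ≡ true →
    atTail w (c x) ℚ.- atHead w (c y) ≡ γ ℚ.* (if y == v then 1ℚ else 0ℚ)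
  arc-equation {x} {y} xy =
    trans (sym (trans (rep x y) (cong (if_then atTail w (c x) ℚ.- atHead w (c y) else 0ℚ) xy)))
          (trans (transfer x y) (cong (λ b → γ ℚ.* (if b ∧ (y == v) then 1ℚ else 0ℚ)) xy))

  arc-off-target : {x y : V} → adj G x y ≡ true → y ≢ v → atTail w (c x) ≡ atHead w (c y)
  arc-off-target {x} {y} xy y≢v = x∙y⁻¹≈ε⇒x≈y _ _ (trans (arc-equation xy)
    (trans (cong (λ b → γ ℚ.* (if b then 1ℚ else 0ℚ)) (≢⇒== y≢v)) (ℚₚ.*-zeroʳ γ)))

  arc-on-target : {x : V} → adj G x v ≡ true → atTail w (c x) ℚ.- atHead w (c v) ≡ γ
  arc-on-target xv = trans (arc-equation xv)
    (trans (cong (λ b → γ ℚ.* (if b then 1ℚ else 0ℚ)) (==-refl v)) (ℚₚ.*-identityʳ γ))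

  same-classes⇒on-target : γ ≢ 0ℚ → {x y x′ : V} → adj G x y ≡ true → adj G x′ v ≡ true →
    c x ≡ c x′ → c y ≡ c v → y ≡ v
  same-classes⇒on-target γ≢0 {x} {y} {x′} xy x′v cx≡cx′ cy≡cv with y ≟ v
  ... | yes y≡v = y≡v
  ... | no  y≢v = ⊥-elim (γ≢0 (begin
    γ                                   ≡⟨ sym (arc-on-target x′v) ⟩
    atTail w (c x′) ℚ.- atHead w (c v)  ≡⟨ cong₂ (λ a b → atTail w a ℚ.- atHead w b)
                                                  (sym cx≡cx′) (sym cy≡cv) ⟩
    atTail w (c x) ℚ.- atHead w (c y)   ≡⟨ cong (ℚ._- atHead w (c y)) (arc-off-target xy y≢v) ⟩
    atHead w (c y) ℚ.- atHead w (c y)   ≡⟨ ℚₚ.+-inverseʳ (atHead w (c y)) ⟩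
    0ℚ                                  ∎))
    where open ≡-Reasoning

-- Lucas sequences

lucasU : ℚ → ℕ → ℚ
lucasU s 0                   = 0ℚ
lucasU s 1                   = 1ℚ
lucasU s (suc (suc t))       = s ℚ.* lucasU s (suc t) ℚ.- lucasU s t

lucasU-unique : ∀ s (f : ℕ → ℚ) → f 0 ≡ 0ℚ → f 1 ≡ 1ℚ →
  (∀ t → f (2 ℕ.+ t) ≡ s ℚ.* f (suc t) ℚ.- f t) → ∀ t → f t ≡ lucasU s t
lucasU-unique s f f₀ f₁ f-rec t = proj₁ (consecutive t)
  where
  consecutive : ∀ t → f t ≡ lucasU s t × f (suc t) ≡ lucasU s (suc t)
  consecutive zero    = f₀ , f₁
  consecutive (suc t) with consecutive t
  ... | ft , ft+1 = ft+1 , trans (f-rec t) (cong₂ (λ a b → s ℚ.* a ℚ.- b) ft+1 ft)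

lucasℤ : ℤ → ℤ → ℕ → ℤ
lucasℤ P Q 0             = + 0
lucasℤ P Q 1             = + 1
lucasℤ P Q (suc (suc t)) = P ℤ.* lucasℤ P Q (suc t) ℤ.- Q ℤ.* lucasℤ P Q t

lucasℤ-mod : ∀ P b c t → ∃ λ q → lucasℤ P (+ b ℤ.* c) (suc t) ≡ P ℤ.^ t ℤ.+ + b ℤ.* q
lucasℤ-mod P b c zero = + 0 , sym (cong (ℤ._+_ (+ 1)) (ℤₚ.*-zeroʳ (+ b)))
lucasℤ-mod P b c (suc t) with lucasℤ-mod P b c t
... | q , eq = P ℤ.* q ℤ.- c ℤ.* lucasℤ P (+ b ℤ.* c) t , (begin
  P ℤ.* lucasℤ P (+ b ℤ.* c) (suc t) ℤ.- (+ b ℤ.* c) ℤ.* L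
    ≡⟨ cong (λ x → P ℤ.* x ℤ.- (+ b ℤ.* c) ℤ.* L) eq ⟩
  P ℤ.* (P ℤ.^ t ℤ.+ + b ℤ.* q) ℤ.- (+ b ℤ.* c) ℤ.* L
    ≡⟨ ℤsolve 6 (λ P Pt B q c L → P ⊛ (Pt ⊕ B ⊛ q) ⊕ ⊝ ((B ⊛ c) ⊛ L)
                                 ⩦ P ⊛ Pt ⊕ B ⊛ (P ⊛ q ⊕ ⊝ (c ⊛ L)))
              refl P (P ℤ.^ t) (+ b) q c L ⟩
  P ℤ.* P ℤ.^ t ℤ.+ + b ℤ.* (P ℤ.* q ℤ.- c ℤ.* L) ∎)
  where
  open ≡-Reasoning
  L = lucasℤ P (+ b ℤ.* c) t

∣^∣ : ∀ i t → ℤ.∣ i ℤ.^ t ∣ ≡ ℤ.∣ i ∣ ℕ.^ t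
∣^∣ i zero    = refl
∣^∣ i (suc t) = trans (ℤₚ.abs-* i (i ℤ.^ t)) (cong (ℤ.∣ i ∣ ℕ.*_) (∣^∣ i t))

coprime-∣^⇒∣1 : ∀ {a b} → Cop.Coprime b a → ∀ t → b ∣ a ℕ.^ t → b ∣ 1
coprime-∣^⇒∣1 coprime zero    b∣1   = b∣1
coprime-∣^⇒∣1 coprime (suc t) b∣a^t = coprime-∣^⇒∣1 coprime t (Cop.coprime-divisor coprime b∣a^t)

lucasℤ-≢0 : ∀ P b c t → Cop.Coprime ℤ.∣ P ∣ b → 2 ≤ b → lucasℤ P (+ b ℤ.* c) (suc t) ≢ + 0
lucasℤ-≢0 P b c t coprime 2≤b L≡0 with lucasℤ-mod P b c t
... | q , L≡ = ℕₚ.<-irrefl (sym b≡1) 2≤b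
  where
  P^t≡ : P ℤ.^ t ≡ ℤ.- (+ b ℤ.* q)
  P^t≡ = trans (ℤsolve 2 (λ x y → x ⩦ (x ⊕ y) ⊕ ⊝ y) refl (P ℤ.^ t) (+ b ℤ.* q))
               (trans (cong (ℤ._- (+ b ℤ.* q)) (trans (sym L≡) L≡0)) (ℤₚ.+-identityˡ _))
  ∣P∣^t≡ : ℤ.∣ P ∣ ℕ.^ t ≡ ℤ.∣ q ∣ ℕ.* b
  ∣P∣^t≡ = begin
    ℤ.∣ P ∣ ℕ.^ t          ≡⟨ sym (∣^∣ P t) ⟩
    ℤ.∣ P ℤ.^ t ∣          ≡⟨ cong ℤ.∣_∣ P^t≡ ⟩
    ℤ.∣ ℤ.- (+ b ℤ.* q) ∣  ≡⟨ ℤₚ.∣-i∣≡∣i∣ (+ b ℤ.* q) ⟩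
    ℤ.∣ + b ℤ.* q ∣        ≡⟨ ℤₚ.abs-* (+ b) q ⟩
    b ℕ.* ℤ.∣ q ∣          ≡⟨ ℕₚ.*-comm b ℤ.∣ q ∣ ⟩
    ℤ.∣ q ∣ ℕ.* b          ∎
    where open ≡-Reasoning
  b≡1 : b ≡ 1
  b≡1 = ∣1⇒≡1 (coprime-∣^⇒∣1 (Cop.sym coprime) t (divides ℤ.∣ q ∣ ∣P∣^t≡))

lucasU-scaled-step : ∀ {s a b} → s ℚ.* ℕtoℚ b ≡ ℤtoℚ a → ∀ t →
  lucasU s (suc t) ℚ.* ℕtoℚ (b ℕ.^ t) ≡ ℤtoℚ (lucasℤ a (+ b ℤ.* + b) (suc t)) →
  lucasU s (2 ℕ.+ t) ℚ.* ℕtoℚ (b ℕ.^ suc t) ≡ ℤtoℚ (lucasℤ a (+ b ℤ.* + b) (2 ℕ.+ t)) →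
  lucasU s (3 ℕ.+ t) ℚ.* ℕtoℚ (b ℕ.^ (2 ℕ.+ t)) ≡ ℤtoℚ (lucasℤ a (+ b ℤ.* + b) (3 ℕ.+ t))
lucasU-scaled-step {s} {a} {b} sb≡a t Lt Lt+1 = begin
  (s ℚ.* U₂ ℚ.- U₁) ℚ.* ℕtoℚ (b ℕ.* (b ℕ.* b ℕ.^ t))
    ≡⟨ cong ((s ℚ.* U₂ ℚ.- U₁) ℚ.*_) (trans (ℕtoℚ-* b _) (cong (B ℚ.*_) (ℕtoℚ-* b _))) ⟩
  (s ℚ.* U₂ ℚ.- U₁) ℚ.* (B ℚ.* (B ℚ.* Bᵗ))
    ≡⟨ solve 5 (λ s U₂ U₁ B Bᵗ → (s :* U₂ :- U₁) :* (B :* (B :* Bᵗ))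
                               := (s :* B) :* (U₂ :* (B :* Bᵗ)) :- (B :* B) :* (U₁ :* Bᵗ))
               refl s U₂ U₁ B Bᵗ ⟩
  (s ℚ.* B) ℚ.* (U₂ ℚ.* (B ℚ.* Bᵗ)) ℚ.- (B ℚ.* B) ℚ.* (U₁ ℚ.* Bᵗ)
    ≡⟨ cong₂ (λ x y → x ℚ.* y ℚ.- (B ℚ.* B) ℚ.* (U₁ ℚ.* Bᵗ)) sb≡a
             (trans (cong (U₂ ℚ.*_) (sym (ℕtoℚ-* b _))) Lt+1) ⟩
  ℤtoℚ a ℚ.* ℤtoℚ (L (2 ℕ.+ t)) ℚ.- (B ℚ.* B) ℚ.* (U₁ ℚ.* Bᵗ)
    ≡⟨ cong₂ (λ x y → ℤtoℚ a ℚ.* ℤtoℚ (L (2 ℕ.+ t)) ℚ.- x ℚ.* y) (sym (ℤtoℚ-* (+ b) (+ b))) Lt ⟩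
  ℤtoℚ a ℚ.* ℤtoℚ (L (2 ℕ.+ t)) ℚ.- ℤtoℚ (+ b ℤ.* + b) ℚ.* ℤtoℚ (L (suc t))
    ≡⟨ sym (trans (ℤtoℚ-- (a ℤ.* L (2 ℕ.+ t)) (+ b ℤ.* + b ℤ.* L (suc t)))
                  (cong₂ ℚ._-_ (ℤtoℚ-* a (L (2 ℕ.+ t))) (ℤtoℚ-* (+ b ℤ.* + b) (L (suc t))))) ⟩
  ℤtoℚ (L (3 ℕ.+ t)) ∎
  where
  open ≡-Reasoning
  B  = ℕtoℚ b
  Bᵗ = ℕtoℚ (b ℕ.^ t)
  L  = lucasℤ a (+ b ℤ.* + b)
  U₂ = lucasU s (2 ℕ.+ t)
  U₁ = lucasU s (suc t)

lucasU-scaled : ∀ {s a b} → s ℚ.* ℕtoℚ b ≡ ℤtoℚ a → ∀ t →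
  lucasU s (suc t) ℚ.* ℕtoℚ (b ℕ.^ t) ≡ ℤtoℚ (lucasℤ a (+ b ℤ.* + b) (suc t))
lucasU-scaled {s} {a} {b} sb≡a t = proj₁ (consecutive t)
  where
  Scaled : ℕ → Set
  Scaled t = lucasU s (suc t) ℚ.* ℕtoℚ (b ℕ.^ t) ≡ ℤtoℚ (lucasℤ a (+ b ℤ.* + b) (suc t))
  consecutive : ∀ t → Scaled t × Scaled (suc t)
  consecutive zero = refl , (begin
    (s ℚ.* 1ℚ ℚ.- 0ℚ) ℚ.* ℕtoℚ (b ℕ.* 1)
      ≡⟨ cong (λ x → (s ℚ.* 1ℚ ℚ.- 0ℚ) ℚ.* ℕtoℚ x) (ℕₚ.*-identityʳ b) ⟩
    (s ℚ.* 1ℚ ℚ.- 0ℚ) ℚ.* ℕtoℚ b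
      ≡⟨ solve 2 (λ s B → (s :* con 1ℚ :- con 0ℚ) :* B := s :* B) refl s (ℕtoℚ b) ⟩
    s ℚ.* ℕtoℚ b
      ≡⟨ sb≡a ⟩
    ℤtoℚ a
      ≡⟨ cong ℤtoℚ (ℤsolve 2 (λ a Q → a ⩦ a ⊛ ℤcon (+ 1) ⊕ ⊝ (Q ⊛ ℤcon (+ 0))) refl a (+ b ℤ.* + b)) ⟩
    ℤtoℚ (lucasℤ a (+ b ℤ.* + b) 2) ∎)
    where open ≡-Reasoning
  consecutive (suc t) with consecutive t
  ... | Lt , Lt+1 = Lt+1 , lucasU-scaled-step sb≡a t Lt Lt+1

lucasU-≢0 : ∀ {s a b} → s ℚ.* ℕtoℚ b ≡ ℤtoℚ a → Cop.Coprime ℤ.∣ a ∣ b → 2 ≤ b →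
  ∀ t → lucasU s (suc t) ≢ 0ℚ
lucasU-≢0 {s} {a} {b} sb≡a coprime 2≤b t U≡0 =
  lucasℤ-≢0 a b (+ b) t coprime 2≤b (ℤtoℚ≡0 _ (begin
    ℤtoℚ (lucasℤ a (+ b ℤ.* + b) (suc t))      ≡⟨ sym (lucasU-scaled sb≡a t) ⟩
    lucasU s (suc t) ℚ.* ℕtoℚ (b ℕ.^ t)       ≡⟨ cong (ℚ._* ℕtoℚ (b ℕ.^ t)) U≡0 ⟩
    0ℚ ℚ.* ℕtoℚ (b ℕ.^ t)                     ≡⟨ ℚₚ.*-zeroˡ (ℕtoℚ (b ℕ.^ t)) ⟩
    0ℚ                                         ∎))
  where open ≡-Reasoning

/-*-ℕtoℚ : ∀ m d y x → m ℕ.* y ≡ x ℕ.* suc d → (+ m / suc d) ℚ.* ℕtoℚ y ≡ ℕtoℚ x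
/-*-ℕtoℚ m d y x my≡xd =
  ℚₚ.toℚᵘ-injective (ℚᵘₚ.≃-trans (ℚₚ.toℚᵘ-homo-* (+ m / suc d) (ℕtoℚ y))
  (ℚᵘₚ.≃-trans (ℚᵘₚ.*-cong (ℚₚ.toℚᵘ-fromℚᵘ (ℚᵘ.mkℚᵘ (+ m) d)) (toℚᵘ-ℤtoℚ (+ y)))
    (ℚᵘₚ.≃-trans (ℚᵘ.*≡* eq) (ℚᵘₚ.≃-sym (toℚᵘ-ℤtoℚ (+ x))))))
  where
  eq : (+ m ℤ.* + y) ℤ.* + 1 ≡ + x ℤ.* (+ suc d ℤ.* + 1)
  eq = trans (ℤₚ.*-identityʳ _) (trans (sym (ℤₚ.pos-* m y)) (trans (cong +_ my≡xd)
         (trans (ℤₚ.pos-* x (suc d)) (cong (+ x ℤ.*_) (sym (ℤₚ.*-identityʳ (+ suc d)))))))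

twoOver-* : ∀ k → 1 ≤ k → twoOver k ℚ.* ℕtoℚ k ≡ ℕtoℚ 2
twoOver-* (suc d) _ = /-*-ℕtoℚ 2 d (suc d) 2 refl

4/k-lowest-terms : ∀ k → 3 ≤ k → k ≢ 4 → ∃₂ λ a b →
  (twoOver k ℚ.+ twoOver k) ℚ.* ℕtoℚ b ≡ ℕtoℚ a × Cop.Coprime a b × 2 ≤ b
4/k-lowest-terms k@(suc d) 3≤k k≢4 = a , b , ratio , Cop.coprime-/gcd 4 k , 2≤b
  where
  g = gcd 4 k
  instance
    g≢0 : ℕ.NonZero g
    g≢0 = ℕ.≢-nonZero (gcd[m,n]≢0 4 k (inj₁ (λ ())))
  a = 4 ℕ./ g
  b = k ℕ./ g
  ag≡4 : a ℕ.* g ≡ 4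
  ag≡4 = m/n*n≡m (gcd[m,n]∣m 4 k)
  bg≡k : b ℕ.* g ≡ k
  bg≡k = m/n*n≡m (gcd[m,n]∣n 4 k)
  2≤b : 2 ≤ b
  2≤b with b in b≡
  ... | 0           = contradiction (trans (sym bg≡k) (cong (ℕ._* g) b≡)) (λ ())
  ... | 1           = contradiction k∣4 (3≤k∤4 k 3≤k k≢4)
    where
    k∣4 : k ∣ 4
    k∣4 = subst (_∣ 4) (trans (sym (ℕₚ.+-identityʳ g)) (trans (cong (ℕ._* g) (sym b≡)) bg≡k))
                (gcd[m,n]∣m 4 k)
    3≤k∤4 : ∀ k → 3 ≤ k → k ≢ 4 → ¬ (k ∣ 4)
    3≤k∤4 k 3≤k k≢4 k∣4 with ℕₚ.≤-antisym (ℕₚ.<⇒≤pred (ℕₚ.≤∧≢⇒< (∣⇒≤ k∣4) k≢4)) 3≤k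
    ... | refl = toWitnessFalse {a? = 3 ∣? 4} _ k∣4
  ... | suc (suc _) = s≤s (s≤s z≤n)
  2[b+b]≡ak : 2 ℕ.* (b ℕ.+ b) ≡ a ℕ.* k
  2[b+b]≡ak = begin
    2 ℕ.* (b ℕ.+ b)     ≡⟨ ℕsolve 1 (λ b → ℕcon 2 ⊛ₙ (b ⊕ₙ b) ⩦ₙ b ⊛ₙ ℕcon 4) refl b ⟩
    b ℕ.* 4             ≡⟨ cong (b ℕ.*_) (sym ag≡4) ⟩
    b ℕ.* (a ℕ.* g)     ≡⟨ ℕsolve 3 (λ a b g → b ⊛ₙ (a ⊛ₙ g) ⩦ₙ a ⊛ₙ (b ⊛ₙ g)) refl a b g ⟩
    a ℕ.* (b ℕ.* g)     ≡⟨ cong (a ℕ.*_) bg≡k ⟩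
    a ℕ.* k             ∎
    where open ≡-Reasoning
  ratio : (twoOver k ℚ.+ twoOver k) ℚ.* ℕtoℚ b ≡ ℕtoℚ a
  ratio = trans (solve 2 (λ z B → (z :+ z) :* B := z :* (B :+ B)) refl (twoOver k) (ℕtoℚ b))
                (trans (cong (twoOver k ℚ.*_) (sym (ℕtoℚ-+ b b)))
                       (/-*-ℕtoℚ 2 d (b ℕ.+ b) a 2[b+b]≡ak))

lucasU-4/k-≢0 : ∀ k → 3 ≤ k → k ≢ 4 →
  ∀ t → lucasU (ℚ.- (twoOver k ℚ.+ twoOver k)) (suc t) ≢ 0ℚ
lucasU-4/k-≢0 k 3≤k k≢4 t with 4/k-lowest-terms k 3≤k k≢4
... | a , b , ratio , coprime , 2≤b = lucasU-≢0 {a = ℤ.- (+ a)} negated-ratio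
  (subst (λ c → Cop.Coprime c b) (sym (ℤₚ.∣-i∣≡∣i∣ (+ a))) coprime) 2≤b t
  where
  negated-ratio : ℚ.- (twoOver k ℚ.+ twoOver k) ℚ.* ℕtoℚ b ≡ ℤtoℚ (ℤ.- (+ a))
  negated-ratio = trans (sym (ℚₚ.neg-distribˡ-* (twoOver k ℚ.+ twoOver k) (ℕtoℚ b)))
                        (trans (cong ℚ.-_ ratio) (sym (ℤtoℚ-neg (+ a))))

-- Cocktail party graphs

record CocktailParty (G : Graph) : Set where
  field
    antipode     : Fin (n G) → Fin (n G)
    antipode-≢   : ∀ x → antipode x ≢ x
    adj-cocktail : ∀ x y → adj G x y ≡ not (x == y) ∧ not (y == antipode x)

unique-antipodes⇒cocktailParty : (G : Graph) → (∀ x → count (λ w → distClass G x w == 2F) ≡ 1) →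
  CocktailParty G
unique-antipodes⇒cocktailParty G unique = record
  { antipode     = σ
  ; antipode-≢   = λ x → proj₁ (distClass≡2F G (σ-class x)) ∘ sym
  ; adj-cocktail = adj-cocktail
  }
  where
  σ-exists = λ x → 1≤count⇒∃ (λ w → distClass G x w == 2F) (ℕₚ.≤-reflexive (sym (unique x)))
  σ : Fin (n G) → Fin (n G)
  σ x = proj₁ (σ-exists x)
  σ-class : ∀ x → distClass G x (σ x) ≡ 2F
  σ-class x = ==⇒≡ (proj₂ (σ-exists x))
  ==2F⇔≡σ : ∀ x y → (distClass G x y == 2F) ≡ (y == σ x)
  ==2F⇔≡σ x y = does-⇔
    (mk⇔ (λ xy₂ → count≡1⇒unique _ (unique x) (≡⇒== xy₂) (proj₂ (σ-exists x))) (λ { refl → σ-class x }))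
    (distClass G x y ≟ 2F) (y ≟ σ x)
  adj-cocktail : ∀ x y → adj G x y ≡ not (x == y) ∧ not (y == σ x)
  adj-cocktail x y with x ≟ y
  ... | yes refl = adj-irrefl G x
  ... | no x≢y   = sym (begin
    not (y == σ x)                 ≡⟨ cong not (sym (==2F⇔≡σ x y)) ⟩
    not (distClass G x y == 2F)    ≡⟨ cong not (distClass==2F-apart G x≢y) ⟩
    not (not (adj G x y))          ≡⟨ Boolₚ.not-involutive (adj G x y) ⟩
    adj G x y                      ∎)
    where open ≡-Reasoning

-- With e = [x ∼ u], a vertex x of a cocktail party graph has e neighbours in each of {u} and
-- {antipode u}, and its other k − 2e neighbours are adjacent to u.
cocktailRow : ℕ → ℕ → Fin 3 → ℕ
cocktailRow k e 0F = e
cocktailRow k e 1F = k ∸ (e ℕ.+ e)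
cocktailRow k e 2F = e

cocktailMatrix : ℕ → Fin 3 → Fin 3 → ℕ
cocktailMatrix k h = cocktailRow k (if h == 1F then 1 else 0)

module CocktailPartyProperties {G : Graph} (cp : CocktailParty G) where

  open CocktailParty cp

  private
    V = Fin (n G)

  ¬adj-antipode : (x : V) → adj G x (antipode x) ≡ false
  ¬adj-antipode x rewrite adj-cocktail x (antipode x) | ==-refl (antipode x) =
    Boolₚ.∧-zeroʳ (not (x == antipode x))

  antipode-involutive : (x : V) → antipode (antipode x) ≡ x
  antipode-involutive x = sym (==⇒≡ (Boolₚ.not-injective (begin
    not (x == antipode (antipode x))
      ≡⟨ cong (_∧ not (x == antipode (antipode x))) (sym (cong not (≢⇒== (antipode-≢ x)))) ⟩
    not (antipode x == x) ∧ not (x == antipode (antipode x))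
      ≡⟨ sym (adj-cocktail (antipode x) x) ⟩
    adj G (antipode x) x
      ≡⟨ adj-sym G (antipode x) x ⟩
    adj G x (antipode x)
      ≡⟨ ¬adj-antipode x ⟩
    false ∎)))
    where open ≡-Reasoning

  antipode-injective : {x y : V} → antipode x ≡ antipode y → x ≡ y
  antipode-injective {x} {y} e =
    trans (sym (antipode-involutive x)) (trans (cong antipode e) (antipode-involutive y))

  ==-antipode : (x y : V) → (x == antipode y) ≡ (y == antipode x)
  ==-antipode x y = does-⇔ (mk⇔ flip flip) (x ≟ antipode y) (y ≟ antipode x)
    where
    flip : ∀ {a b} → a ≡ antipode b → b ≡ antipode a
    flip {a} {b} refl = sym (antipode-involutive b)

  adj-antipode : (x y : V) → adj G x (antipode y) ≡ adj G x y
  adj-antipode x y = begin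
    adj G x (antipode y)
      ≡⟨ adj-cocktail x (antipode y) ⟩
    not (x == antipode y) ∧ not (antipode y == antipode x)
      ≡⟨ cong₂ (λ a b → not a ∧ not b) (==-antipode x y)
               (does-⇔ (mk⇔ antipode-injective (cong antipode)) (antipode y ≟ antipode x) (y ≟ x)) ⟩
    not (y == antipode x) ∧ not (y == x)
      ≡⟨ Boolₚ.∧-comm (not (y == antipode x)) _ ⟩
    not (y == x) ∧ not (y == antipode x)
      ≡⟨ cong (λ a → not a ∧ not (y == antipode x)) (==-sym y x) ⟩
    not (x == y) ∧ not (y == antipode x)
      ≡⟨ sym (adj-cocktail x y) ⟩
    adj G x y ∎
    where open ≡-Reasoning

  distClass==2F : (u w : V) → (distClass G u w == 2F) ≡ (w == antipode u)
  distClass==2F u w with u ≟ w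
  ... | yes refl = sym (≢⇒== (antipode-≢ u ∘ sym))
  ... | no u≢w rewrite adj-cocktail u w | ≢⇒== u≢w with w == antipode u
  ...   | true  = refl
  ...   | false = refl

  distClass-antipode : (u : V) → distClass G u (antipode u) ≡ 2F
  distClass-antipode u = ==⇒≡ (trans (distClass==2F u (antipode u)) (==-refl (antipode u)))

  deg+2≡n : (x : V) → deg G x ℕ.+ 2 ≡ n G
  deg+2≡n x = trans (cong (ℕ._+ 2) (count-cong λ w → trans (adj-cocktail x w)
                                        (cong (λ b → not b ∧ not (w == antipode x)) (==-sym x w))))
                    (count-avoiding-two (antipode-≢ x ∘ sym))

  regular-of-order : ∀ {k} → n G ≡ k ℕ.+ 2 → ∀ x → deg G x ≡ k
  regular-of-order {k} order x = ℕₚ.+-cancelʳ-≡ 2 (deg G x) k (trans (deg+2≡n x) order)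

  module _ {k : ℕ} (regular : ∀ x → deg G x ≡ k) where

    cocktail-equitable : ∀ u → Equitable G (distClass G u) (cocktailMatrix k)
    cocktail-equitable u x j = trans (row j)
      (cong (λ b → cocktailRow k (if b then 1 else 0) j) (sym (trans (distClass==1F G u x) (adj-sym G u x))))
      where
      N = classCount (adj G x) (distClass G u)
      e = if adj G x u then 1 else 0
      N₀≡e : N 0F ≡ e
      N₀≡e = trans (count-cong (λ w → cong (adj G x w ∧_) (trans (distClass==0F G u w) (==-sym u w))))
                   (count-at (adj G x) u)
      N₂≡e : N 2F ≡ e
      N₂≡e = trans (count-cong (λ w → cong (adj G x w ∧_) (distClass==2F u w)))
                   (trans (count-at (adj G x) (antipode u)) (cong (if_then 1 else 0) (adj-antipode x u)))
      k≡ : k ≡ e ℕ.+ (N 1F ℕ.+ e)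
      k≡ = trans (sym (regular x)) (trans (count-classes₃ (adj G x) (distClass G u))
                                          (cong₂ (λ a b → a ℕ.+ (N 1F ℕ.+ b)) N₀≡e N₂≡e))
      row : ∀ j → N j ≡ cocktailRow k e j
      row 0F = N₀≡e
      row 1F = sym (begin
        k ∸ (e ℕ.+ e)
          ≡⟨ cong (_∸ (e ℕ.+ e)) k≡ ⟩
        (e ℕ.+ (N 1F ℕ.+ e)) ∸ (e ℕ.+ e)
          ≡⟨ cong (_∸ (e ℕ.+ e)) (ℕsolve 2 (λ e N → e ⊕ₙ (N ⊕ₙ e) ⩦ₙ N ⊕ₙ (e ⊕ₙ e)) refl e (N 1F)) ⟩
        (N 1F ℕ.+ (e ℕ.+ e)) ∸ (e ℕ.+ e)
          ≡⟨ ℕₚ.m+n∸n≡m (N 1F) (e ℕ.+ e) ⟩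
        N 1F ∎)
        where open ≡-Reasoning
      row 2F = N₂≡e

    neighbour : 1 ≤ k → ∀ u → ∃ λ y → adj G u y ≡ true
    neighbour 1≤k u = 1≤count⇒∃ (adj G u) (subst (1 ≤_) (sym (regular u)) 1≤k)

    triangle : 3 ≤ k → ∀ u → ∃₂ λ y x → adj G u y ≡ true × adj G y x ≡ true × adj G u x ≡ true
    triangle 3≤k u with neighbour (ℕₚ.≤-trans (s≤s z≤n) 3≤k) u
    ... | y , uy with 1≤count⇒∃ (λ x → adj G y x ∧ (distClass G u x == 1F))
                     (subst (1 ≤_) (sym (trans (cocktail-equitable u y 1F)
                                                (cong (λ h → cocktailMatrix k h 1F) (distClass-adj G {u} {y} uy))))
                            (ℕₚ.∸-monoˡ-≤ 2 3≤k))
    ...   | x , yx∧ux₁ with ∧-true {adj G y x} yx∧ux₁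
    ...     | yx , ux₁ = y , x , uy , yx , trans (sym (distClass==1F G u x)) ux₁

second-difference : (Fin 3 → ℚ) → ℚ
second-difference f = f 0F ℚ.+ f 2F ℚ.- (f 1F ℚ.+ f 1F)

second-difference-const : ∀ f {h} → f 0F ≡ h → f 1F ≡ h → f 2F ≡ h → second-difference f ≡ 0ℚ
second-difference-const f {h} f₀ f₁ f₂ rewrite f₀ | f₁ | f₂ = ℚₚ.+-inverseʳ (h ℚ.+ h)

cocktail-second-difference : ∀ k z → 2 ≤ k → z ℚ.* ℕtoℚ k ≡ ℕtoℚ 2 → ∀ w →
  second-difference (atTail (walkStep (cocktailMatrix k) z w)) ≡
  ℚ.- (z ℚ.+ z) ℚ.* second-difference (atTail w) ℚ.- second-difference (atHead w)
cocktail-second-difference 0       z () _ _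
cocktail-second-difference 1       z (s≤s ()) _ _
cocktail-second-difference (suc (suc d)) z _ zk (arcWeights β α) rewrite ℕtoℚ-+ 2 d = begin
  _ ≡⟨ solve 8 (λ z b₀ b₁ b₂ a₀ a₁ a₂ D →
         let K = con (ℕtoℚ 2) :+ D
             tail₀ = z :* ((b₀ :- a₀) :* con 0ℚ :+ ((b₁ :- a₀) :* K :+ ((b₂ :- a₀) :* con 0ℚ :+ con 0ℚ))) :+ a₀
             tail₁ = z :* ((b₀ :- a₁) :* con 1ℚ :+ ((b₁ :- a₁) :* D :+ ((b₂ :- a₁) :* con 1ℚ :+ con 0ℚ))) :+ a₁
             tail₂ = z :* ((b₀ :- a₂) :* con 0ℚ :+ ((b₁ :- a₂) :* K :+ ((b₂ :- a₂) :* con 0ℚ :+ con 0ℚ))) :+ a₂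
             Δα = a₀ :+ a₂ :- (a₁ :+ a₁)
         in tail₀ :+ tail₂ :- (tail₁ :+ tail₁)
            := :- (z :+ z) :* (b₀ :+ b₂ :- (b₁ :+ b₁)) :- Δα :+ (con (ℕtoℚ 2) :- z :* K) :* Δα)
       refl z (β 0F) (β 1F) (β 2F) (α 0F) (α 1F) (α 2F) (ℕtoℚ d) ⟩
  X ℚ.+ (ℕtoℚ 2 ℚ.- z ℚ.* (ℕtoℚ 2 ℚ.+ ℕtoℚ d)) ℚ.* Δα
    ≡⟨ cong (λ t → X ℚ.+ (ℕtoℚ 2 ℚ.- t) ℚ.* Δα) zk ⟩
  X ℚ.+ (ℕtoℚ 2 ℚ.- ℕtoℚ 2) ℚ.* Δα
    ≡⟨ solve 2 (λ X Δ → X :+ (con (ℕtoℚ 2) :- con (ℕtoℚ 2)) :* Δ := X) refl X Δα ⟩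
  X ∎
  where
  open ≡-Reasoning
  Δα = second-difference α
  X = ℚ.- (z ℚ.+ z) ℚ.* second-difference β ℚ.- Δα

module CocktailWalk {G : Graph} (cp : CocktailParty G) {k : ℕ} (regular : ∀ x → deg G x ≡ k)
                    (u : Fin (n G)) where

  open CocktailParty cp
  open CocktailPartyProperties cp

  private
    V = Fin (n G)
    z = twoOver k

  walk : ℕ → ArcWeights 3
  walk = classWalk (cocktailMatrix k) z 0F

  open EquitablePartition G (distClass G u) (cocktailMatrix k) (cocktail-equitable regular u)
    using (transfer-from-classes)

  represents : ∀ t → Represents G (distClass G u) (walk t) (iter t (U G) (χ G u))
  represents = EquitablePartition.represents-walk G (distClass G u) (cocktailMatrix k)
    (cocktail-equitable regular u) regular u (λ y → trans (distClass==0F G u y) (==-sym u y))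

  second-difference-walk : 2 ≤ k → ∀ t →
    second-difference (atTail (walk t)) ≡ lucasU (ℚ.- (z ℚ.+ z)) t
  second-difference-walk 2≤k = lucasU-unique _ (λ t → second-difference (atTail (walk t)))
    refl
    (trans (step 0) (solve 1 (λ s → s :* con 0ℚ :- con (ℚ.- 1ℚ) := con 1ℚ) refl (ℚ.- (z ℚ.+ z))))
    (λ t → step (suc t))
    where
    step : ∀ t → second-difference (atTail (walk (suc t))) ≡
      ℚ.- (z ℚ.+ z) ℚ.* second-difference (atTail (walk t)) ℚ.- second-difference (atHead (walk t))
    step t = cocktail-second-difference k z 2≤k (twoOver-* k (ℕₚ.≤-trans (s≤s z≤n) 2≤k)) (walk t)

  transfer-to-antipode : ∀ τ → 1 ≤ τ →
    (∀ h j → 1 ≤ cocktailMatrix k h j →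
       atTail (walk τ) h ℚ.- atHead (walk τ) j ≡ (if j == 2F then 1ℚ else 0ℚ)) →
    PerfectStateTransfer G
  transfer-to-antipode τ 1≤τ check =
    u , antipode u , antipode-≢ u ∘ sym , τ , 1≤τ , 1ℚ , scaling ,
    transfer-from-classes {walk τ} (represents τ) (antipode u) class-of-σu
      (subst (λ c → ∀ h j → 1 ≤ cocktailMatrix k h j →
                     atTail (walk τ) h ℚ.- atHead (walk τ) j ≡ (if j == c then 1ℚ else 0ℚ))
             (sym (distClass-antipode u)) check)
    where
    class-of-σu : ∀ y → (distClass G u y == distClass G u (antipode u)) ≡ (y == antipode u)
    class-of-σu y = trans (cong (distClass G u y ==_) (distClass-antipode u)) (distClass==2F u y)
    scaling : 1ℚ ℚ.* 1ℚ ℚ.* ℕtoℚ (deg G (antipode u)) ≡ ℕtoℚ (deg G u)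
    scaling = trans (ℚₚ.*-identityˡ _) (cong ℕtoℚ (trans (regular (antipode u)) (sym (regular u))))

  transfer⇒second-difference≡0 : 3 ≤ k → ∀ τ γ →
    (∀ x y → iter τ (U G) (χ G u) x y ≡ γ ℚ.* χ G (antipode u) x y) →
    second-difference (atTail (walk τ)) ≡ 0ℚ
  transfer⇒second-difference≡0 3≤k τ γ transfer with triangle regular 3≤k u
  ... | y , x , uy , yx , ux = second-difference-const (atTail (walk τ))
    (arc-into-y (distClass-self G u) uy)
    (arc-into-y (distClass-adj G {u} {x} ux) (trans (adj-sym G x y) yx))
    (arc-into-y (distClass-antipode u)
                (trans (adj-sym G (antipode u) y) (trans (adj-antipode y u) (trans (adj-sym G y u) uy))))
    where
    open TransferOnClasses G (distClass G u) (walk τ) (represents τ) (antipode u) γ transfer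
    y≢σu : y ≢ antipode u
    y≢σu y≡σu = true≢false (trans (sym uy) (trans (cong (adj G u) y≡σu) (¬adj-antipode u)))
    arc-into-y : ∀ {h v} → distClass G u v ≡ h → adj G v y ≡ true →
      atTail (walk τ) h ≡ atHead (walk τ) 1F
    arc-into-y refl vy =
      subst (λ j → _ ≡ atHead (walk τ) j) (distClass-adj G {u} {y} uy) (arc-off-target vy y≢σu)

  transfer⇒degree≡4 : 3 ≤ k → ∀ τ → 1 ≤ τ → ∀ γ →
    (∀ x y → iter τ (U G) (χ G u) x y ≡ γ ℚ.* χ G (antipode u) x y) → k ≡ 4
  transfer⇒degree≡4 3≤k (suc t) _ γ transfer with k ℕ.≟ 4
  ... | yes k≡4 = k≡4
  ... | no  k≢4 = ⊥-elim (lucasU-4/k-≢0 k 3≤k k≢4 t (begin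
    lucasU (ℚ.- (z ℚ.+ z)) (suc t)
      ≡⟨ sym (second-difference-walk (ℕₚ.≤-trans (s≤s (s≤s z≤n)) 3≤k) (suc t)) ⟩
    second-difference (atTail (walk (suc t)))
      ≡⟨ transfer⇒second-difference≡0 3≤k (suc t) γ transfer ⟩
    0ℚ ∎))
    where open ≡-Reasoning

γ²-scaling⇒γ≢0 : ∀ {γ a b} → γ ℚ.* γ ℚ.* ℕtoℚ a ≡ ℕtoℚ b → 1 ≤ b → γ ≢ 0ℚ
γ²-scaling⇒γ≢0 {γ} {a} {b} scaling 1≤b γ≡0 = ℕₚ.<-irrefl (sym b≡0) 1≤b
  where
  b≡0 : b ≡ 0
  b≡0 = ℤₚ.+-injective (ℤtoℚ≡0 (+ b) (begin
    ℕtoℚ b                  ≡⟨ sym scaling ⟩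
    γ ℚ.* γ ℚ.* ℕtoℚ a      ≡⟨ cong (λ c → c ℚ.* c ℚ.* ℕtoℚ a) γ≡0 ⟩
    0ℚ ℚ.* 0ℚ ℚ.* ℕtoℚ a    ≡⟨ ℚₚ.*-zeroˡ (ℕtoℚ a) ⟩
    0ℚ                      ∎))
    where open ≡-Reasoning

module TransferInDiameterTwo (G : Graph) (drg : DistanceRegular G) (dia : Diameter2 G)
    {u v : Fin (n G)} (u≢v : u ≢ v) {τ : ℕ} {γ : ℚ}
    (scaling : γ ℚ.* γ ℚ.* ℕtoℚ (deg G v) ≡ ℕtoℚ (deg G u))
    (transfer : ∀ x y → iter τ (U G) (χ G u) x y ≡ γ ℚ.* χ G v x y) where

  open DiameterTwo G (proj₁ dia)
  open DistanceRegularDiameterTwo G drg (proj₁ dia)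

  private
    P = proj₁ (distance-partition-equitable u)
    regularᵤ : ∀ x → deg G x ≡ deg G u
    regularᵤ x = regular x u
    γ≢0 : γ ≢ 0ℚ
    γ≢0 = γ²-scaling⇒γ≢0 {γ} {deg G v} {deg G u} scaling
            (ℕₚ.≤-trans (s≤s z≤n) (2≤deg (proj₂ dia) u))

  open EquitablePartition G (distClass G u) P (proj₂ (distance-partition-equitable u))
  open TransferOnClasses G (distClass G u) (classWalk P (twoOver (deg G u)) 0F τ)
    (represents-walk regularᵤ u (λ y → trans (distClass==0F G u y) (==-sym u y)) τ) v γ transfer

  target-at-distance-2 : distClass G u v ≡ 2F
  target-at-distance-2 = by-class (distClass G u v) refl
    where
    by-class : ∀ h → distClass G u v ≡ h → distClass G u v ≡ 2F
    by-class 0F uv = ⊥-elim (u≢v (distClass≡0F G uv))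
    by-class 1F uv =
      let y , y≢v , uy = 2≤count⇒∃≢ (adj G u) (2≤deg (proj₂ dia) u) v
      in ⊥-elim (y≢v (same-classes⇒on-target γ≢0 uy (distClass≡1F G uv) refl
                        (trans (distClass-adj G uy) (sym uv))))
    by-class 2F uv = uv

  at-distance-2⇒target : ∀ {y} → distClass G u y ≡ 2F → y ≡ v
  at-distance-2⇒target uy₂ =
    let x  , ux  , xy  = common-neighbour uy₂
        x′ , ux′ , x′v = common-neighbour target-at-distance-2
    in same-classes⇒on-target γ≢0 xy x′v
         (trans (distClass-adj G {u} {x} ux) (sym (distClass-adj G {u} {x′} ux′)))
         (trans uy₂ (sym target-at-distance-2))

  cocktailParty : CocktailParty G
  cocktailParty = unique-antipodes⇒cocktailParty G λ x → begin
    count (λ w → distClass G x w == 2F)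
      ≡⟨ antipodes-invariant x u ⟩
    count (λ w → distClass G u w == 2F)
      ≡⟨ count-cong (λ y → does-⇔ (mk⇔ at-distance-2⇒target (λ { refl → target-at-distance-2 }))
                                  (distClass G u y ≟ 2F) (y ≟ v)) ⟩
    count (λ w → w == v)
      ≡⟨ count-at (λ _ → true) v ⟩
    1 ∎
    where open ≡-Reasoning

  target≡antipode : v ≡ CocktailParty.antipode cocktailParty u
  target≡antipode = ==⇒≡ (trans (sym (CocktailPartyProperties.distClass==2F cocktailParty u v))
                                (≡⇒== target-at-distance-2))

module _ {a b : ℕ} (f : Fin a ↔ Fin b) where

  open Inverse f

  to-injective : ∀ {x y} → to x ≡ to y → x ≡ y
  to-injective {x} {y} e = trans (sym (strictlyInverseʳ x)) (trans (cong from e) (strictlyInverseʳ y))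

  from-injective : ∀ {x y} → from x ≡ from y → x ≡ y
  from-injective {x} {y} e = trans (sym (strictlyInverseˡ x)) (trans (cong to e) (strictlyInverseˡ y))

  to-== : ∀ x t → (to x == t) ≡ (x == from t)
  to-== x t = does-⇔ (mk⇔ (λ e → sym (inverseʳ (sym e))) inverseˡ) (to x ≟ t) (x ≟ from t)

  to-==-to : ∀ x y → (to x == to y) ≡ (x == y)
  to-==-to x y = trans (to-== x (to y)) (cong (x ==_) (strictlyInverseʳ y))

≅⇒order≡ : {G H : Graph} → Isomorphic G H → n G ≡ n H
≅⇒order≡ (f , _) = Finₚ.cantor-schröder-bernstein (to-injective f) (from-injective f)

≅-cocktailParty : {G H : Graph} → Isomorphic G H → CocktailParty H → CocktailParty G
≅-cocktailParty {G} {H} (f , adj≡) cpH = record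
  { antipode     = λ x → from (antipode (to x))
  ; antipode-≢   = λ x e → antipode-≢ (to x) (trans (sym (strictlyInverseˡ _)) (cong to e))
  ; adj-cocktail = λ x y → begin
      adj G x y
        ≡⟨ adj≡ x y ⟩
      adj H (to x) (to y)
        ≡⟨ adj-cocktail (to x) (to y) ⟩
      not (to x == to y) ∧ not (to y == antipode (to x))
        ≡⟨ cong₂ (λ a b → not a ∧ not b) (to-==-to f x y) (to-== f y (antipode (to x))) ⟩
      not (x == y) ∧ not (y == from (antipode (to x))) ∎
  }
  where
  open Inverse f
  open CocktailParty cpH
  open ≡-Reasoning

injective⇒surjective : ∀ {a b} {g : Fin a → Fin b} → b ≡ a → (∀ {i j} → g i ≡ g j → i ≡ j) →
  ∀ y → ∃ λ i → g i ≡ y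
injective⇒surjective {a} {b} {g} b≡a g-injective y with Finₚ.any? (λ i → g i ≟ y)
... | yes found = found
... | no  ∄i    = ⊥-elim (ℕₚ.<-irrefl (sym b≡a) (Finₚ.injective⇒≤ extended-injective))
  where
  extended : Fin (suc a) → Fin b
  extended zero    = y
  extended (suc i) = g i
  extended-injective : ∀ {i j} → extended i ≡ extended j → i ≡ j
  extended-injective {zero}  {zero}  _ = refl
  extended-injective {zero}  {suc j} e = ⊥-elim (∄i (j , sym e))
  extended-injective {suc i} {zero}  e = ⊥-elim (∄i (i , e))
  extended-injective {suc i} {suc j} e = cong suc (g-injective e)

antipodal-bijection⇒≅ : {G H : Graph} (cpG : CocktailParty G) (cpH : CocktailParty H) →
  (g : Fin (n H) → Fin (n G)) → (∀ {i j} → g i ≡ g j → i ≡ j) → n G ≡ n H →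
  (∀ i → g (CocktailParty.antipode cpH i) ≡ CocktailParty.antipode cpG (g i)) → Isomorphic G H
antipodal-bijection⇒≅ {G} {H} cpG cpH g g-injective order g-antipode =
  mk↔ₛ′ h g (λ i → g-injective (g∘h (g i))) g∘h , adj≡
  where
  open CocktailParty
  h : Fin (n G) → Fin (n H)
  h x = proj₁ (injective⇒surjective order g-injective x)
  g∘h : ∀ x → g (h x) ≡ x
  g∘h x = proj₂ (injective⇒surjective order g-injective x)
  g-==-g : ∀ i j → (g i == g j) ≡ (i == j)
  g-==-g i j = does-⇔ (mk⇔ g-injective (cong g)) (g i ≟ g j) (i ≟ j)
  adj-g : ∀ i j → adj G (g i) (g j) ≡ adj H i j
  adj-g i j = begin
    adj G (g i) (g j)
      ≡⟨ adj-cocktail cpG (g i) (g j) ⟩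
    not (g i == g j) ∧ not (g j == antipode cpG (g i))
      ≡⟨ cong (λ t → not (g i == g j) ∧ not (g j == t)) (sym (g-antipode i)) ⟩
    not (g i == g j) ∧ not (g j == g (antipode cpH i))
      ≡⟨ cong₂ (λ a b → not a ∧ not b) (g-==-g i j) (g-==-g j _) ⟩
    not (i == j) ∧ not (j == antipode cpH i)
      ≡⟨ sym (adj-cocktail cpH i j) ⟩
    adj H i j ∎
    where open ≡-Reasoning
  adj≡ : ∀ x y → adj G x y ≡ adj H (h x) (h y)
  adj≡ x y = trans (cong₂ (adj G) (sym (g∘h x)) (sym (g∘h y))) (adj-g (h x) (h y))

halfSwap : ∀ p → Fin (p ℕ.+ p) → Fin (p ℕ.+ p)
halfSwap p = join p p ∘ Sum.swap ∘ splitAt p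

halfSwap-≢ : ∀ p i → halfSwap p i ≢ i
halfSwap-≢ p i e = swap-≢ (splitAt p i)
  (trans (sym (Finₚ.splitAt-join p p (Sum.swap (splitAt p i)))) (cong (splitAt p) e))
  where
  swap-≢ : ∀ (s : Fin p ⊎ Fin p) → Sum.swap s ≢ s
  swap-≢ (inj₁ _) ()
  swap-≢ (inj₂ _) ()

multipartite-cocktailParty : ∀ {p q} (part : Fin (p ℕ.+ p) → Fin q) →
  (∀ i j → not (part i == part j) ≡ not (i == j) ∧ not (j == halfSwap p i)) →
  CocktailParty (multipartite part)
multipartite-cocktailParty {p} part adj≡ = record
  { antipode = halfSwap p ; antipode-≢ = halfSwap-≢ p ; adj-cocktail = adj≡ }

C4-antipodal : ∀ i j → not (c4part i == c4part j) ≡ not (i == j) ∧ not (j == halfSwap 2 i)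
C4-antipodal = toWitness {a? = all? λ i → all? λ j →
  not (c4part i == c4part j) Boolₚ.≟ (not (i == j) ∧ not (j == halfSwap 2 i))} _

K222-antipodal : ∀ i j → not (k222part i == k222part j) ≡ not (i == j) ∧ not (j == halfSwap 3 i)
K222-antipodal = toWitness {a? = all? λ i → all? λ j →
  not (k222part i == k222part j) Boolₚ.≟ (not (i == j) ∧ not (j == halfSwap 3 i))} _

module CliqueEmbedding {G : Graph} (cp : CocktailParty G) {p : ℕ} (xs : Fin p → Fin (n G))
    (clique : ∀ i j → i ≢ j → adj G (xs i) (xs j) ≡ true) where

  open CocktailParty cp
  open CocktailPartyProperties cp

  embed : Fin (p ℕ.+ p) → Fin (n G)
  embed = [ xs , antipode ∘ xs ]′ ∘ splitAt p

  private
    xs-injective : ∀ {i j} → xs i ≡ xs j → i ≡ j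
    xs-injective {i} {j} e with i ≟ j
    ... | yes i≡j = i≡j
    ... | no  i≢j = ⊥-elim (true≢false (trans (sym (clique i j i≢j))
                                              (trans (cong (adj G (xs i)) (sym e)) (adj-irrefl G (xs i)))))

    xs-apart : ∀ i j → xs i ≢ antipode (xs j)
    xs-apart i j e with i ≟ j
    ... | yes refl = antipode-≢ (xs i) (sym e)
    ... | no  i≢j  = true≢false (trans (sym (clique j i (i≢j ∘ sym)))
                                      (trans (cong (adj G (xs j)) e) (¬adj-antipode (xs j))))

    both-injective : ∀ {s t : Fin p ⊎ Fin p} →
      [ xs , antipode ∘ xs ]′ s ≡ [ xs , antipode ∘ xs ]′ t → s ≡ t
    both-injective {inj₁ i} {inj₁ j} e = cong inj₁ (xs-injective e)
    both-injective {inj₁ i} {inj₂ j} e = ⊥-elim (xs-apart i j e)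
    both-injective {inj₂ i} {inj₁ j} e = ⊥-elim (xs-apart j i (sym e))
    both-injective {inj₂ i} {inj₂ j} e = cong inj₂ (xs-injective (antipode-injective e))

  embed-injective : ∀ {i j} → embed i ≡ embed j → i ≡ j
  embed-injective {i} {j} e =
    trans (sym (Finₚ.join-splitAt p p i))
          (trans (cong (join p p) (both-injective {splitAt p i} {splitAt p j} e)) (Finₚ.join-splitAt p p j))

  embed-halfSwap : ∀ i → embed (halfSwap p i) ≡ antipode (embed i)
  embed-halfSwap i rewrite Finₚ.splitAt-join p p (Sum.swap (splitAt p i)) with splitAt p i
  ... | inj₁ a = refl
  ... | inj₂ a = sym (antipode-involutive (xs a))

  clique≅multipartite : n G ≡ p ℕ.+ p → ∀ {q} (part : Fin (p ℕ.+ p) → Fin q) →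
    (adj≡ : ∀ i j → not (part i == part j) ≡ not (i == j) ∧ not (j == halfSwap p i)) →
    Isomorphic G (multipartite part)
  clique≅multipartite order part adj≡ =
    antipodal-bijection⇒≅ cp (multipartite-cocktailParty {p} part adj≡) embed embed-injective order embed-halfSwap

cocktailParty⇒≅C4 : {G : Graph} → CocktailParty G → n G ≡ 4 → Isomorphic G C4
cocktailParty⇒≅C4 {G} cp order = from-edge (neighbour (regular-of-order {2} order) (s≤s z≤n) u)
  where
  open CocktailPartyProperties cp
  u = subst Fin (sym order) 0F
  from-edge : (∃ λ y → adj G u y ≡ true) → Isomorphic G C4
  from-edge (y , uy) = CliqueEmbedding.clique≅multipartite cp edge edge-clique order c4part C4-antipodal
    where
    edge : Fin 2 → Fin (n G)
    edge 0F = u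
    edge 1F = y
    edge-clique : ∀ i j → i ≢ j → adj G (edge i) (edge j) ≡ true
    edge-clique 0F 0F i≢j = ⊥-elim (i≢j refl)
    edge-clique 0F 1F _   = uy
    edge-clique 1F 0F _   = trans (adj-sym G y u) uy
    edge-clique 1F 1F i≢j = ⊥-elim (i≢j refl)

cocktailParty⇒≅K222 : {G : Graph} → CocktailParty G → n G ≡ 6 → Isomorphic G K222
cocktailParty⇒≅K222 {G} cp order =
  from-triangle (triangle (regular-of-order {4} order) (s≤s (s≤s (s≤s z≤n))) u)
  where
  open CocktailPartyProperties cp
  u = subst Fin (sym order) 0F
  from-triangle : (∃₂ λ y x → adj G u y ≡ true × adj G y x ≡ true × adj G u x ≡ true) →
    Isomorphic G K222
  from-triangle (y , x , uy , yx , ux) =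
    CliqueEmbedding.clique≅multipartite cp corner corner-clique order k222part K222-antipodal
    where
    corner : Fin 3 → Fin (n G)
    corner 0F = u
    corner 1F = y
    corner 2F = x
    corner-clique : ∀ i j → i ≢ j → adj G (corner i) (corner j) ≡ true
    corner-clique 0F 1F _ = uy
    corner-clique 0F 2F _ = ux
    corner-clique 1F 0F _ = trans (adj-sym G y u) uy
    corner-clique 1F 2F _ = yx
    corner-clique 2F 0F _ = trans (adj-sym G x u) ux
    corner-clique 2F 1F _ = trans (adj-sym G x y) yx
    corner-clique 0F 0F i≢j = ⊥-elim (i≢j refl)
    corner-clique 1F 1F i≢j = ⊥-elim (i≢j refl)
    corner-clique 2F 2F i≢j = ⊥-elim (i≢j refl)

C4⇒transfer : {G : Graph} → Isomorphic G C4 → PerfectStateTransfer G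
C4⇒transfer {G} iso = transfer-to-antipode 2 (s≤s z≤n) check
  where
  cp = ≅-cocktailParty {G} {C4} iso (multipartite-cocktailParty {2} c4part C4-antipodal)
  open CocktailWalk cp (CocktailPartyProperties.regular-of-order cp {2} (≅⇒order≡ {G} {C4} iso))
                       (Inverse.from (proj₁ iso) 0F)
  check : ∀ h j → 1 ≤ cocktailMatrix 2 h j →
    atTail (walk 2) h ℚ.- atHead (walk 2) j ≡ (if j == 2F then 1ℚ else 0ℚ)
  check 0F 1F _ = refl
  check 1F 0F _ = refl
  check 1F 2F _ = refl
  check 2F 1F _ = refl
  check 0F 0F ()
  check 0F 2F ()
  check 1F 1F ()
  check 2F 0F ()
  check 2F 2F ()

K222⇒transfer : {G : Graph} → Isomorphic G K222 → PerfectStateTransfer G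
K222⇒transfer {G} iso = transfer-to-antipode 6 (s≤s z≤n) check
  where
  cp = ≅-cocktailParty {G} {K222} iso (multipartite-cocktailParty {3} k222part K222-antipodal)
  open CocktailWalk cp (CocktailPartyProperties.regular-of-order cp {4} (≅⇒order≡ {G} {K222} iso))
                       (Inverse.from (proj₁ iso) 0F)
  check : ∀ h j → 1 ≤ cocktailMatrix 4 h j →
    atTail (walk 6) h ℚ.- atHead (walk 6) j ≡ (if j == 2F then 1ℚ else 0ℚ)
  check 0F 1F _ = refl
  check 1F 0F _ = refl
  check 1F 1F _ = refl
  check 1F 2F _ = refl
  check 2F 1F _ = refl
  check 0F 0F ()
  check 0F 2F ()
  check 2F 0F ()
  check 2F 2F ()

transfer⇒C4⊎K222 : (G : Graph) → DistanceRegular G → Diameter2 G →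
  PerfectStateTransfer G → Isomorphic G C4 ⊎ Isomorphic G K222
transfer⇒C4⊎K222 G drg dia (u , v , u≢v , τ , 1≤τ , γ , scaling , transfer) = by-degree degree-2-or-4
  where
  open TransferInDiameterTwo G drg dia {u} {v} u≢v {τ} {γ} scaling transfer
    using (cocktailParty; target≡antipode)
  open CocktailPartyProperties cocktailParty using (deg+2≡n)
  regular : ∀ x → deg G x ≡ deg G u
  regular x = DistanceRegularDiameterTwo.regular G drg (proj₁ dia) x u
  2≤k : 2 ≤ deg G u
  2≤k = DistanceRegularDiameterTwo.2≤deg G drg (proj₁ dia) (proj₂ dia) u
  degree-2-or-4 : deg G u ≡ 2 ⊎ deg G u ≡ 4
  degree-2-or-4 with 3 ℕ.≤? deg G u
  ... | no  k≱3 = inj₁ (ℕₚ.≤-antisym (ℕₚ.≤-pred (ℕₚ.≰⇒> k≱3)) 2≤k)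
  ... | yes 3≤k = inj₂ (CocktailWalk.transfer⇒degree≡4 cocktailParty regular u 3≤k τ 1≤τ γ
    (subst (λ w → ∀ x y → iter τ (U G) (χ G u) x y ≡ γ ℚ.* χ G w x y) target≡antipode transfer))
  by-degree : deg G u ≡ 2 ⊎ deg G u ≡ 4 → Isomorphic G C4 ⊎ Isomorphic G K222
  order : ∀ {k} → deg G u ≡ k → n G ≡ k ℕ.+ 2
  order k≡ = trans (sym (deg+2≡n u)) (cong (ℕ._+ 2) k≡)
  by-degree (inj₁ k≡2) = inj₁ (cocktailParty⇒≅C4 cocktailParty (order k≡2))
  by-degree (inj₂ k≡4) = inj₂ (cocktailParty⇒≅K222 cocktailParty (order k≡4))

theorem4p5 : (G : Graph) → DistanceRegular G → Diameter2 G →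
    PerfectStateTransfer G ⇔ (Isomorphic G C4 ⊎ Isomorphic G K222)
theorem4p5 G drg dia = mk⇔ (transfer⇒C4⊎K222 G drg dia) [ C4⇒transfer {G} , K222⇒transfer {G} ]′
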